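{- Let $n\ge 2$. Let $\mathcal{C}_{n,k}$ denote a set of representatives of the equivalence classes of ternary LCD $[n,k]$ codes and $\mathcal{C}_{n,k,d}$ a set of representatives of the equivalence classes of ternary LCD $[n,k,d]$ codes. Then: (i) for $1\le d\le n$, $|\mathcal{C}_{n,1,d}|=1$ if $d\not\equiv 0\pmod 3$, and $|\mathcal{C}_{n,1,d}|=0$ otherwise. (ii) $|\mathcal{C}_{n,1}|=|\mathcal{C}_{n,n-1}|$ equals $2n/3$ if $n\equiv 0\pmod 3$, $(2n+1)/3$ if $n\equiv 1\pmod 3$, and $(2n+2)/3$ if $n\equiv 2\pmod 3$. (iii) $|\mathcal{C}_{n,n-1,d}|$ equals $2n/3$ if $n\equiv 0\pmod 3$ and $d=1$; $(2n+1)/3-1$ if $n\equiv 1\pmod 3$ and $d=1$; $1$ if $n\equiv 1\pmod 3$ and $d=2$; $(2n+2)/3-1$ if $n\equiv 2\pmod 3$ and $d=1$; $1$ if $n\equiv 2\pmod 3$ and $d=2$; and $0$ otherwise.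
   Context: A ternary $[n,k]$ code is a $k$-dimensional subspace of $\mathbb{F}_3^n$; an $[n,k,d]$ code is one whose minimum nonzero Hamming weight is $d$. Two ternary codes $C,C'$ of length $n$ are equivalent if $C'=\{xP\mid x\in C\}$ for some $n\times n$ monomial matrix $P$ over $\mathbb{F}_3$. $C^\perp$ is the dual code with respect to the standard inner product; $C$ is LCD if $C\cap C^\perp=\{\mathbf{0}_n\}$. -}

module Defs where

open import Data.Nat using (ℕ; zero; suc; _≤_; _∸_; _+_; _*_; _/_; _%_)
open import Data.Fin using (Fin)
open import Data.Vec using (Vec; []; _∷_; replicate; map; lookup; tabulate; zipWith; foldr)
open import Data.Product using (Σ; ∃; _×_; _,_)
open import Relation.Binary.PropositionalEquality using (_≡_; _≢_)
open import Function.Bundles using (_⇔_)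

data F3 : Set where
  𝟘 𝟙 𝟚 : F3

infixl 6 _⊕_
infixl 7 _⊗_

_⊕_ : F3 → F3 → F3
𝟘 ⊕ y = y
𝟙 ⊕ 𝟘 = 𝟙
𝟙 ⊕ 𝟙 = 𝟚
𝟙 ⊕ 𝟚 = 𝟘
𝟚 ⊕ 𝟘 = 𝟚
𝟚 ⊕ 𝟙 = 𝟘
𝟚 ⊕ 𝟚 = 𝟙

_⊗_ : F3 → F3 → F3
𝟘 ⊗ y = 𝟘
𝟙 ⊗ y = y
𝟚 ⊗ 𝟘 = 𝟘
𝟚 ⊗ 𝟙 = 𝟚
𝟚 ⊗ 𝟚 = 𝟙

Word : ℕ → Set
Word n = Vec F3 n

Mat : ℕ → ℕ → Set
Mat m n = Vec (Word n) m

0w : (n : ℕ) → Word n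
0w n = replicate n 𝟘

sumF : ∀ {n} → Word n → F3
sumF = foldr _ _⊕_ 𝟘

_·_ : ∀ {n} → Word n → Word n → F3
x · y = sumF (zipWith _⊗_ x y)

column : ∀ {m n} → Mat m n → Fin n → Word m
column G j = map (λ r → lookup r j) G

_✕_ : ∀ {m n} → Word m → Mat m n → Word n
x ✕ G = tabulate (λ j → x · column G j)

wt : ∀ {n} → Word n → ℕ
wt [] = 0
wt (𝟘 ∷ x) = wt x
wt (𝟙 ∷ x) = suc (wt x)
wt (𝟚 ∷ x) = suc (wt x)

-- Ternary [n,k] codes, given by a k × n generator matrix of rank k
-- (the code is the row space; rank k = rows linearly independent,
-- so the code is a k-dimensional subspace of F₃ⁿ).

LinIndepRows : ∀ {k n} → Mat k n → Set
LinIndepRows {k} {n} G = ∀ (m : Word k) → m ✕ G ≡ 0w n → m ≡ 0w k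

record Code (n k : ℕ) : Set where
  field
    gen   : Mat k n
    indep : LinIndepRows gen
open Code public

_∈C_ : ∀ {n k} → Word n → Code n k → Set
x ∈C C = ∃ λ m → m ✕ gen C ≡ x

_∈C⊥_ : ∀ {n k} → Word n → Code n k → Set
x ∈C⊥ C = ∀ y → y ∈C C → x · y ≡ 𝟘

IsLCD : ∀ {n k} → Code n k → Set
IsLCD {n} C = ∀ x → x ∈C C → x ∈C⊥ C → x ≡ 0w n

MinWeight : ∀ {n k} → Code n k → ℕ → Set
MinWeight {n} C d =
  (∀ x → x ∈C C → x ≢ 0w n → d ≤ wt x) ×
  (∃ λ x → x ∈C C × x ≢ 0w n × wt x ≡ d)

entry : ∀ {n} → Mat n n → Fin n → Fin n → F3
entry P i j = lookup (lookup P i) j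

IsMonomial : ∀ {n} → Mat n n → Set
IsMonomial P =
  (∀ i → ∃ λ j → entry P i j ≢ 𝟘 × (∀ j' → entry P i j' ≢ 𝟘 → j' ≡ j)) ×
  (∀ j → ∃ λ i → entry P i j ≢ 𝟘 × (∀ i' → entry P i' j ≢ 𝟘 → i' ≡ i))

Equivalent : ∀ {n k k'} → Code n k → Code n k' → Set
Equivalent {n} C C' = ∃ λ (P : Mat n n) → IsMonomial P ×
  (∀ y → (y ∈C C') ⇔ (∃ λ x → x ∈C C × y ≡ x ✕ P))

-- A set of representatives of the equivalence classes of [n,k] codes
-- satisfying a property Q, having exactly N elements.

record Representatives (n k : ℕ) (Q : Code n k → Set) (N : ℕ) : Set where
  field
    rep      : Fin N → Code n k
    rep-Q    : ∀ i → Q (rep i)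
    distinct : ∀ i j → Equivalent (rep i) (rep j) → i ≡ j
    complete : ∀ C → Q C → ∃ λ i → Equivalent C (rep i)

NumLCD : ℕ → ℕ → ℕ → Set
NumLCD n k N = Representatives n k IsLCD N

NumLCDd : ℕ → ℕ → ℕ → ℕ → Set
NumLCDd n k d N = Representatives n k (λ C → IsLCD C × MinWeight C d) N

valI : ℕ → ℕ
valI d with d % 3
... | 0 = 0
... | _ = 1

valII : ℕ → ℕ
valII n with n % 3
... | 0 = (2 * n) / 3
... | 1 = (2 * n + 1) / 3
... | _ = (2 * n + 2) / 3

valIII : ℕ → ℕ → ℕ
valIII n d = go (n % 3) d
  where
  go : ℕ → ℕ → ℕ
  go 0 1 = (2 * n) / 3
  go 1 1 = (2 * n + 1) / 3 ∸ 1
  go 1 2 = 1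
  go 2 1 = (2 * n + 2) / 3 ∸ 1
  go 2 2 = 1
  go _ _ = 0

-- An [n,1] code ⟨g⟩ is LCD iff g · g ≠ 0, and g · g is wt g modulo 3. Monomial maps preserve
-- weights and inner products, and every word is monomially equivalent to 𝟙ʷ𝟘ⁿ⁻ʷ, so the LCD
-- [n,1] codes up to equivalence correspond to the weights 1 ≤ w ≤ n with 3 ∤ w, the minimum
-- distance being w. Dually, an [n,n-1] code is the hyperplane orthogonal to a nonzero check
-- vector h; it is LCD iff h · h ≠ 0, and its class is again determined by wt h. The hyperplane
-- orthogonal to 𝟙ʷ𝟘ⁿ⁻ʷ has minimum distance 1 if w < n and 2 if w = n. Counting the weights
-- 1 ≤ w ≤ n with 3 ∤ w gives the values in the statement.
module Submission where

open import Defs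
open import Data.Nat using (ℕ; zero; suc; _≤_; _<_; _∸_; _+_; _*_; _/_; _%_; z≤n; s≤s)
import Data.Nat.Properties as ℕ
open import Data.Nat.DivMod using (m≡m%n+[m/n]*n; m*n/n≡m; m%n<n)
open import Data.Nat.Tactic.RingSolver using (solve-∀)
open import Data.Fin using (Fin; zero; suc; punchIn; punchOut; fromℕ<)
import Data.Fin.Properties as Fin
open import Data.Fin.Permutation as Perm using (Permutation; _⟨$⟩ʳ_; _⟨$⟩ˡ_)
open import Data.Vec using ([]; _∷_; head; tail; replicate; map; lookup; tabulate; zipWith)
import Data.Vec.Properties as Vec
open import Data.Product using (∃; _×_; _,_; proj₁; proj₂)
open import Data.Sum using (_⊎_; inj₁; inj₂)
open import Data.Empty using (⊥-elim)
open import Relation.Nullary using (¬_; Dec; yes; no; ¬?; _→-dec_)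
open import Relation.Nullary.Decidable using (from-yes)
open import Relation.Unary using (Decidable)
open import Relation.Binary.Definitions using (DecidableEquality)
open import Relation.Binary.PropositionalEquality
open import Function.Base using (_∘_)
open import Function.Bundles using (_⇔_; mk⇔; module Equivalence)
open import Algebra.Bundles using (CommutativeMonoid)
import Algebra.Properties.CommutativeMonoid.Sum as Sum

open Equivalence using (to; from)

infix 8 -_
-_ : F3 → F3
- 𝟘 = 𝟘
- 𝟙 = 𝟚
- 𝟚 = 𝟙

infix 4 _≟F_
_≟F_ : DecidableEquality F3
𝟘 ≟F 𝟘 = yes refl
𝟙 ≟F 𝟙 = yes refl
𝟚 ≟F 𝟚 = yes refl
𝟘 ≟F 𝟙 = no λ ()
𝟘 ≟F 𝟚 = no λ ()
𝟙 ≟F 𝟘 = no λ ()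
𝟙 ≟F 𝟚 = no λ ()
𝟚 ≟F 𝟘 = no λ ()
𝟚 ≟F 𝟙 = no λ ()

-- F₃ is finite, so each of its identities below is proved by deciding all cases.
∀F? : {P : F3 → Set} → Decidable P → Dec (∀ a → P a)
∀F? P? with P? 𝟘 | P? 𝟙 | P? 𝟚
... | yes p₀ | yes p₁ | yes p₂ = yes λ { 𝟘 → p₀ ; 𝟙 → p₁ ; 𝟚 → p₂ }
... | no ¬p  | _      | _      = no λ p → ¬p (p 𝟘)
... | yes _  | no ¬p  | _      = no λ p → ¬p (p 𝟙)
... | yes _  | yes _  | no ¬p  = no λ p → ¬p (p 𝟚)

⊕-comm : ∀ a b → a ⊕ b ≡ b ⊕ a
⊕-comm = from-yes (∀F? λ a → ∀F? λ b → a ⊕ b ≟F b ⊕ a)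

⊕-assoc : ∀ a b c → (a ⊕ b) ⊕ c ≡ a ⊕ (b ⊕ c)
⊕-assoc = from-yes (∀F? λ a → ∀F? λ b → ∀F? λ c → (a ⊕ b) ⊕ c ≟F a ⊕ (b ⊕ c))

⊕-identityʳ : ∀ a → a ⊕ 𝟘 ≡ a
⊕-identityʳ = from-yes (∀F? λ a → a ⊕ 𝟘 ≟F a)

-‿inverseˡ : ∀ a → - a ⊕ a ≡ 𝟘
-‿inverseˡ = from-yes (∀F? λ a → - a ⊕ a ≟F 𝟘)

⊕≡𝟘⇒≡- : ∀ a b → a ⊕ b ≡ 𝟘 → a ≡ - b
⊕≡𝟘⇒≡- = from-yes (∀F? λ a → ∀F? λ b → (a ⊕ b ≟F 𝟘) →-dec (a ≟F - b))

⊗-comm : ∀ a b → a ⊗ b ≡ b ⊗ a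
⊗-comm = from-yes (∀F? λ a → ∀F? λ b → a ⊗ b ≟F b ⊗ a)

⊗-assoc : ∀ a b c → (a ⊗ b) ⊗ c ≡ a ⊗ (b ⊗ c)
⊗-assoc = from-yes (∀F? λ a → ∀F? λ b → ∀F? λ c → (a ⊗ b) ⊗ c ≟F a ⊗ (b ⊗ c))

⊗-identityʳ : ∀ a → a ⊗ 𝟙 ≡ a
⊗-identityʳ = from-yes (∀F? λ a → a ⊗ 𝟙 ≟F a)

⊗-zeroʳ : ∀ a → a ⊗ 𝟘 ≡ 𝟘
⊗-zeroʳ = from-yes (∀F? λ a → a ⊗ 𝟘 ≟F 𝟘)

⊗-distribˡ-⊕ : ∀ a b c → a ⊗ (b ⊕ c) ≡ a ⊗ b ⊕ a ⊗ c
⊗-distribˡ-⊕ = from-yes (∀F? λ a → ∀F? λ b → ∀F? λ c → a ⊗ (b ⊕ c) ≟F a ⊗ b ⊕ a ⊗ c)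

⊗-distribʳ-⊕ : ∀ a b c → (a ⊕ b) ⊗ c ≡ a ⊗ c ⊕ b ⊗ c
⊗-distribʳ-⊕ = from-yes (∀F? λ a → ∀F? λ b → ∀F? λ c → (a ⊕ b) ⊗ c ≟F a ⊗ c ⊕ b ⊗ c)

⊗-left-comm : ∀ a b c → a ⊗ (b ⊗ c) ≡ b ⊗ (a ⊗ c)
⊗-left-comm = from-yes (∀F? λ a → ∀F? λ b → ∀F? λ c → a ⊗ (b ⊗ c) ≟F b ⊗ (a ⊗ c))

⊗-self : ∀ a → a ≢ 𝟘 → a ⊗ a ≡ 𝟙
⊗-self = from-yes (∀F? λ a → ¬? (a ≟F 𝟘) →-dec (a ⊗ a ≟F 𝟙))

⊗≡𝟘⇒≡𝟘 : ∀ a b → a ≢ 𝟘 → a ⊗ b ≡ 𝟘 → b ≡ 𝟘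
⊗≡𝟘⇒≡𝟘 = from-yes (∀F? λ a → ∀F? λ b →
  ¬? (a ≟F 𝟘) →-dec ((a ⊗ b ≟F 𝟘) →-dec (b ≟F 𝟘)))

⊕-interchange : ∀ a b c d → (a ⊕ b) ⊕ (c ⊕ d) ≡ (a ⊕ c) ⊕ (b ⊕ d)
⊕-interchange = from-yes (∀F? λ a → ∀F? λ b → ∀F? λ c → ∀F? λ d →
  (a ⊕ b) ⊕ (c ⊕ d) ≟F (a ⊕ c) ⊕ (b ⊕ d))

⊕-commutativeMonoid : CommutativeMonoid _ _
⊕-commutativeMonoid = record
  { Carrier = F3 ; _≈_ = _≡_ ; _∙_ = _⊕_ ; ε = 𝟘
  ; isCommutativeMonoid = record
    { isMonoid = record
      { isSemigroup = record
        { isMagma = record { isEquivalence = isEquivalence ; ∙-cong = cong₂ _⊕_ }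
        ; assoc = ⊕-assoc }
      ; identity = (λ _ → refl) , ⊕-identityʳ }
    ; comm = ⊕-comm } }

module ΣF = Sum ⊕-commutativeMonoid
module Σℕ = Sum ℕ.+-0-commutativeMonoid

infixl 6 _+ᵥ_
_+ᵥ_ : ∀ {n} → Word n → Word n → Word n
_+ᵥ_ = zipWith _⊕_

infixl 7 _•_
_•_ : ∀ {n} → F3 → Word n → Word n
c • x = map (c ⊗_) x

lookup-ext : ∀ {n} {u v : Word n} → (∀ i → lookup u i ≡ lookup v i) → u ≡ v
lookup-ext {u = u} {v} eq = begin
  u                    ≡⟨ Vec.tabulate∘lookup u ⟨
  tabulate (lookup u)  ≡⟨ Vec.tabulate-cong eq ⟩
  tabulate (lookup v)  ≡⟨ Vec.tabulate∘lookup v ⟩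
  v                    ∎
  where open ≡-Reasoning

lookup-0w : ∀ {n} (i : Fin n) → lookup (0w n) i ≡ 𝟘
lookup-0w i = Vec.lookup-replicate i 𝟘

lookup-•+ᵥ : ∀ {n} c (x y : Word n) j → lookup (c • x +ᵥ y) j ≡ c ⊗ lookup x j ⊕ lookup y j
lookup-•+ᵥ c x y j =
  trans (Vec.lookup-zipWith _⊕_ j (c • x) y) (cong (_⊕ lookup y j) (Vec.lookup-map j (c ⊗_) x))

𝟘• : ∀ {n} (x : Word n) → 𝟘 • x ≡ 0w n
𝟘• []      = refl
𝟘• (_ ∷ x) = cong (𝟘 ∷_) (𝟘• x)

𝟙• : ∀ {n} (x : Word n) → 𝟙 • x ≡ x
𝟙• []      = refl
𝟙• (a ∷ x) = cong (a ∷_) (𝟙• x)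

+ᵥ-identityˡ : ∀ {n} (x : Word n) → 0w n +ᵥ x ≡ x
+ᵥ-identityˡ []      = refl
+ᵥ-identityˡ (a ∷ x) = cong (a ∷_) (+ᵥ-identityˡ x)

+ᵥ-identityʳ : ∀ {n} (x : Word n) → x +ᵥ 0w n ≡ x
+ᵥ-identityʳ []      = refl
+ᵥ-identityʳ (a ∷ x) = cong₂ _∷_ (⊕-identityʳ a) (+ᵥ-identityʳ x)

≢0w⇒∃≢𝟘 : ∀ {n} (x : Word n) → x ≢ 0w n → ∃ λ j → lookup x j ≢ 𝟘
≢0w⇒∃≢𝟘 []      x≢0 = ⊥-elim (x≢0 refl)
≢0w⇒∃≢𝟘 (a ∷ x) x≢0 with a ≟F 𝟘
... | no a≢0   = zero , a≢0
... | yes refl with ≢0w⇒∃≢𝟘 x (x≢0 ∘ cong (𝟘 ∷_))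
...   | j , xⱼ≢0 = suc j , xⱼ≢0

•≡0w⇒≡𝟘 : ∀ {n} a (x : Word n) → x ≢ 0w n → a • x ≡ 0w n → a ≡ 𝟘
•≡0w⇒≡𝟘 a x x≢0 ax≡0 with ≢0w⇒∃≢𝟘 x x≢0
... | j , xⱼ≢0 = ⊗≡𝟘⇒≡𝟘 _ a xⱼ≢0 (begin
  lookup x j ⊗ a      ≡⟨ ⊗-comm _ a ⟩
  a ⊗ lookup x j      ≡⟨ Vec.lookup-map j (a ⊗_) x ⟨
  lookup (a • x) j    ≡⟨ cong (λ v → lookup v j) ax≡0 ⟩
  lookup (0w _) j     ≡⟨ lookup-0w j ⟩
  𝟘                   ∎)
  where open ≡-Reasoning

•+ᵥ≡0w⇒ : ∀ {n} c (x y : Word n) → c ≢ 𝟘 → c • x +ᵥ y ≡ 0w n → x ≡ (- c) • y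
•+ᵥ≡0w⇒ c x y c≢0 eq = lookup-ext λ j → begin
  lookup x j              ≡⟨ solve c (lookup x j) (lookup y j) c≢0 (lookup-sum j) ⟩
  - c ⊗ lookup y j        ≡⟨ Vec.lookup-map j (- c ⊗_) y ⟨
  lookup ((- c) • y) j    ∎
  where
  open ≡-Reasoning
  solve : ∀ c a b → c ≢ 𝟘 → c ⊗ a ⊕ b ≡ 𝟘 → a ≡ - c ⊗ b
  solve = from-yes (∀F? λ c → ∀F? λ a → ∀F? λ b →
    ¬? (c ≟F 𝟘) →-dec ((c ⊗ a ⊕ b ≟F 𝟘) →-dec (a ≟F - c ⊗ b)))
  lookup-sum : ∀ j → c ⊗ lookup x j ⊕ lookup y j ≡ 𝟘
  lookup-sum j = trans (sym (lookup-•+ᵥ c x y j)) (trans (cong (λ v → lookup v j) eq) (lookup-0w j))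

unit : ∀ {n} → Fin n → Word n
unit {suc n} zero = 𝟙 ∷ 0w n
unit (suc j)      = 𝟘 ∷ unit j

lookup-unit-diag : ∀ {n} (j : Fin n) → lookup (unit j) j ≡ 𝟙
lookup-unit-diag zero    = refl
lookup-unit-diag (suc j) = lookup-unit-diag j

lookup-unit-off : ∀ {n} (j j' : Fin n) → j ≢ j' → lookup (unit j) j' ≡ 𝟘
lookup-unit-off zero    zero     j≢j' = ⊥-elim (j≢j' refl)
lookup-unit-off zero    (suc j') _    = lookup-0w j'
lookup-unit-off (suc j) zero     _    = refl
lookup-unit-off (suc j) (suc j') j≢j' = lookup-unit-off j j' (j≢j' ∘ cong suc)

·-comm : ∀ {n} (x y : Word n) → x · y ≡ y · x
·-comm []      []      = refl
·-comm (a ∷ x) (b ∷ y) = cong₂ _⊕_ (⊗-comm a b) (·-comm x y)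

·-zeroˡ : ∀ {n} (y : Word n) → 0w n · y ≡ 𝟘
·-zeroˡ []      = refl
·-zeroˡ (_ ∷ y) = ·-zeroˡ y

·-zeroʳ : ∀ {n} (y : Word n) → y · 0w n ≡ 𝟘
·-zeroʳ y = trans (·-comm y _) (·-zeroˡ y)

∷-· : ∀ {n} (x : Word (suc n)) b (h : Word n) → x · (b ∷ h) ≡ head x ⊗ b ⊕ tail x · h
∷-· (a ∷ x) b h = refl

·-distribʳ-+ᵥ : ∀ {n} (u w h : Word n) → (u +ᵥ w) · h ≡ u · h ⊕ w · h
·-distribʳ-+ᵥ []      []      []      = refl
·-distribʳ-+ᵥ (a ∷ u) (b ∷ w) (c ∷ h) = begin
  (a ⊕ b) ⊗ c ⊕ (u +ᵥ w) · h           ≡⟨ cong₂ _⊕_ (⊗-distribʳ-⊕ a b c) (·-distribʳ-+ᵥ u w h) ⟩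
  (a ⊗ c ⊕ b ⊗ c) ⊕ (u · h ⊕ w · h)    ≡⟨ ⊕-interchange (a ⊗ c) (b ⊗ c) (u · h) (w · h) ⟩
  (a ⊗ c ⊕ u · h) ⊕ (b ⊗ c ⊕ w · h)    ∎
  where open ≡-Reasoning

•-· : ∀ {n} c (u h : Word n) → (c • u) · h ≡ c ⊗ (u · h)
•-· c []      []      = sym (⊗-zeroʳ c)
•-· c (a ∷ u) (b ∷ h) = trans (cong₂ _⊕_ (⊗-assoc c a b) (•-· c u h)) (sym (⊗-distribˡ-⊕ c _ _))

·-• : ∀ {n} c (u h : Word n) → h · (c • u) ≡ c ⊗ (h · u)
·-• c u h = trans (·-comm h _) (trans (•-· c u h) (cong (c ⊗_) (·-comm u h)))

·-unit : ∀ {n} (x : Word n) j → x · unit j ≡ lookup x j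
·-unit (a ∷ x) zero    = trans (cong₂ _⊕_ (⊗-identityʳ a) (·-zeroʳ x)) (⊕-identityʳ a)
·-unit (a ∷ x) (suc j) = trans (cong (_⊕ x · unit j) (⊗-zeroʳ a)) (·-unit x j)

·-supported : ∀ {n} (h v : Word n) j₀ → (∀ j → j ≢ j₀ → lookup v j ≡ 𝟘) →
  h · v ≡ lookup h j₀ ⊗ lookup v j₀
·-supported (a ∷ h) (b ∷ v) zero outside = begin
  a ⊗ b ⊕ h · v        ≡⟨ cong (λ u → a ⊗ b ⊕ h · u)
                            (lookup-ext λ i → trans (outside (suc i) λ ()) (sym (lookup-0w i))) ⟩
  a ⊗ b ⊕ h · 0w _     ≡⟨ cong (a ⊗ b ⊕_) (·-zeroʳ h) ⟩
  a ⊗ b ⊕ 𝟘            ≡⟨ ⊕-identityʳ _ ⟩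
  a ⊗ b                ∎
  where open ≡-Reasoning
·-supported (a ∷ h) (b ∷ v) (suc j₀) outside =
  cong₂ _⊕_ (trans (cong (a ⊗_) (outside zero λ ())) (⊗-zeroʳ a))
            (·-supported h v j₀ λ j j≢j₀ → outside (suc j) (j≢j₀ ∘ Fin.suc-injective))

·-as-sum : ∀ {n} (x y : Word n) → x · y ≡ ΣF.sum (λ i → lookup x i ⊗ lookup y i)
·-as-sum []      []      = refl
·-as-sum (a ∷ x) (b ∷ y) = cong (a ⊗ b ⊕_) (·-as-sum x y)

isNonzero : F3 → ℕ
isNonzero 𝟘 = 0
isNonzero 𝟙 = 1
isNonzero 𝟚 = 1

isNonzero-⊗ : ∀ a b → a ≢ 𝟘 → isNonzero (a ⊗ b) ≡ isNonzero b
isNonzero-⊗ = from-yes (∀F? λ a → ∀F? λ b → ¬? (a ≟F 𝟘) →-dec (isNonzero (a ⊗ b) ℕ.≟ isNonzero b))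

wt-as-sum : ∀ {n} (x : Word n) → wt x ≡ Σℕ.sum (λ i → isNonzero (lookup x i))
wt-as-sum []      = refl
wt-as-sum (𝟘 ∷ x) = wt-as-sum x
wt-as-sum (𝟙 ∷ x) = cong suc (wt-as-sum x)
wt-as-sum (𝟚 ∷ x) = cong suc (wt-as-sum x)

infixl 7 _⊙_
_⊙_ : ∀ {k n} → Mat k n → Word n → Word k
G ⊙ h = tabulate (λ i → lookup G i · h)

lookup-✕ : ∀ {m n} (x : Word m) (G : Mat m n) j → lookup (x ✕ G) j ≡ x · column G j
lookup-✕ x G j = Vec.lookup∘tabulate (λ j → x · column G j) j

lookup-column : ∀ {m n} (G : Mat m n) j i → lookup (column G j) i ≡ lookup (lookup G i) j
lookup-column G j i = Vec.lookup-map i (λ r → lookup r j) G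

[]✕ : ∀ {n} (G : Mat 0 n) → [] ✕ G ≡ 0w n
[]✕ [] = lookup-ext λ j → trans (Vec.lookup∘tabulate _ j) (sym (lookup-0w j))

∷✕∷ : ∀ {k n} a (m : Word k) (r : Word n) (G : Mat k n) → (a ∷ m) ✕ (r ∷ G) ≡ a • r +ᵥ m ✕ G
∷✕∷ a m r G = lookup-ext λ j → begin
  lookup ((a ∷ m) ✕ (r ∷ G)) j         ≡⟨ Vec.lookup∘tabulate _ j ⟩
  a ⊗ lookup r j ⊕ m · column G j       ≡⟨ cong (a ⊗ lookup r j ⊕_) (lookup-✕ m G j) ⟨
  a ⊗ lookup r j ⊕ lookup (m ✕ G) j     ≡⟨ lookup-•+ᵥ a r (m ✕ G) j ⟨
  lookup (a • r +ᵥ m ✕ G) j             ∎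
  where open ≡-Reasoning

•✕ : ∀ {k n} c (m : Word k) (G : Mat k n) → (c • m) ✕ G ≡ c • (m ✕ G)
•✕ c m G = lookup-ext λ j → begin
  lookup ((c • m) ✕ G) j      ≡⟨ lookup-✕ (c • m) G j ⟩
  (c • m) · column G j        ≡⟨ •-· c m (column G j) ⟩
  c ⊗ (m · column G j)        ≡⟨ cong (c ⊗_) (lookup-✕ m G j) ⟨
  c ⊗ lookup (m ✕ G) j        ≡⟨ Vec.lookup-map j (c ⊗_) (m ✕ G) ⟨
  lookup (c • (m ✕ G)) j      ∎
  where open ≡-Reasoning

✕-· : ∀ {k n} (m : Word k) (G : Mat k n) (h : Word n) → (m ✕ G) · h ≡ m · (G ⊙ h)
✕-· []      []      h = trans (cong (_· h) ([]✕ [])) (·-zeroˡ h)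
✕-· (a ∷ m) (r ∷ G) h = begin
  ((a ∷ m) ✕ (r ∷ G)) · h        ≡⟨ cong (_· h) (∷✕∷ a m r G) ⟩
  (a • r +ᵥ m ✕ G) · h           ≡⟨ ·-distribʳ-+ᵥ (a • r) (m ✕ G) h ⟩
  (a • r) · h ⊕ (m ✕ G) · h      ≡⟨ cong₂ _⊕_ (•-· a r h) (✕-· m G h) ⟩
  a ⊗ (r · h) ⊕ m · (G ⊙ h)      ∎
  where open ≡-Reasoning

-- Gaussian elimination on the first coordinate: a pivot row clears it from the other rows, the
-- remaining k rows are solved in one dimension less, and the first coordinate of h is then
-- chosen to satisfy the pivot row (in F₃ every nonzero a is its own inverse).
nonzero-orthogonal : ∀ {k n} → k < n → (R : Fin k → Word n) →
  ∃ λ h → h ≢ 0w n × (∀ i → R i · h ≡ 𝟘)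
nonzero-orthogonal {zero}  {suc n} _ R = unit zero , (λ ()) , λ ()
nonzero-orthogonal {suc k} {suc n} (s≤s k<n) R with Fin.any? (λ i → ¬? (head (R i) ≟F 𝟘))
... | no noPivot = 𝟙 ∷ 0w n , (λ ()) , λ i → begin
  R i · (𝟙 ∷ 0w n)                        ≡⟨ ∷-· (R i) 𝟙 (0w n) ⟩
  head (R i) ⊗ 𝟙 ⊕ tail (R i) · 0w n      ≡⟨ cong₂ _⊕_ (trans (⊗-identityʳ _) (headZero i))
                                                        (·-zeroʳ (tail (R i))) ⟩
  𝟘                                       ∎
  where
  open ≡-Reasoning
  headZero : ∀ i → head (R i) ≡ 𝟘
  headZero i with head (R i) ≟F 𝟘
  ... | yes z   = z
  ... | no nz   = ⊥-elim (noPivot (i , nz))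
... | yes (p , aₚ≢0) = b ∷ h' , h'≢0 ∘ cong tail , orthogonal
  where
  aₚ = head (R p)
  other : Fin k → Word (suc n)
  other j = R (punchIn p j)
  μ : Fin k → F3
  μ j = - (head (other j) ⊗ aₚ)
  reduced : Fin k → Word n
  reduced j = tail (other j) +ᵥ μ j • tail (R p)
  solution = nonzero-orthogonal k<n reduced
  h' = proj₁ solution
  h'≢0 = proj₁ (proj₂ solution)
  s = tail (R p) · h'
  b = - (aₚ ⊗ s)
  pivotRow : ∀ a s → a ≢ 𝟘 → a ⊗ - (a ⊗ s) ⊕ s ≡ 𝟘
  pivotRow = from-yes (∀F? λ a → ∀F? λ s → ¬? (a ≟F 𝟘) →-dec (a ⊗ - (a ⊗ s) ⊕ s ≟F 𝟘))
  otherRow : ∀ a a' s → a ⊗ - (a' ⊗ s) ⊕ - (- (a ⊗ a') ⊗ s) ≡ 𝟘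
  otherRow = from-yes (∀F? λ a → ∀F? λ a' → ∀F? λ s → a ⊗ - (a' ⊗ s) ⊕ - (- (a ⊗ a') ⊗ s) ≟F 𝟘)
  tail-other : ∀ j → tail (other j) · h' ≡ - (μ j ⊗ s)
  tail-other j = ⊕≡𝟘⇒≡- _ _ (begin
    tail (other j) · h' ⊕ μ j ⊗ s                ≡⟨ cong (tail (other j) · h' ⊕_) (•-· (μ j) (tail (R p)) h') ⟨
    tail (other j) · h' ⊕ (μ j • tail (R p)) · h' ≡⟨ ·-distribʳ-+ᵥ (tail (other j)) (μ j • tail (R p)) h' ⟨
    reduced j · h'                                ≡⟨ proj₂ (proj₂ solution) j ⟩
    𝟘                                             ∎)
    where open ≡-Reasoning
  orthogonal : ∀ i → R i · (b ∷ h') ≡ 𝟘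
  orthogonal i with i Fin.≟ p
  ... | yes refl = trans (∷-· (R p) b h') (pivotRow aₚ s aₚ≢0)
  ... | no i≢p = begin
    R i · (b ∷ h')                                ≡⟨ cong (λ i → R i · (b ∷ h')) (Fin.punchIn-punchOut p≢i) ⟨
    other j · (b ∷ h')                            ≡⟨ ∷-· (other j) b h' ⟩
    head (other j) ⊗ b ⊕ tail (other j) · h'      ≡⟨ cong (head (other j) ⊗ b ⊕_) (tail-other j) ⟩
    head (other j) ⊗ b ⊕ - (μ j ⊗ s)              ≡⟨ otherRow (head (other j)) aₚ s ⟩
    𝟘                                             ∎
    where
    open ≡-Reasoning
    p≢i : p ≢ i
    p≢i = i≢p ∘ sym
    j = punchOut p≢i

orthogonal-rows⇒dependent : ∀ {n} (M : Mat n n) (h : Word n) → h ≢ 0w n → M ⊙ h ≡ 0w n →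
  ∃ λ c → c ≢ 0w n × c ✕ M ≡ 0w n
orthogonal-rows⇒dependent {zero}  M [] h≢0 _ = ⊥-elim (h≢0 refl)
orthogonal-rows⇒dependent {suc n} M h h≢0 Mh≡0 = c , c≢0 , lookup-ext λ j → trans (cM≡0 j) (sym (lookup-0w j))
  where
  -- c kills every column of M except one where h is nonzero; orthogonality to h kills that one too.
  j₀ = proj₁ (≢0w⇒∃≢𝟘 h h≢0)
  hⱼ₀≢0 = proj₂ (≢0w⇒∃≢𝟘 h h≢0)
  orth = nonzero-orthogonal (ℕ.n<1+n n) (λ j → column M (punchIn j₀ j))
  c = proj₁ orth
  c≢0 = proj₁ (proj₂ orth)
  cM≡0-off-j₀ : ∀ j → j ≢ j₀ → lookup (c ✕ M) j ≡ 𝟘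
  cM≡0-off-j₀ j j≢j₀ = begin
    lookup (c ✕ M) j                     ≡⟨ lookup-✕ c M j ⟩
    c · column M j                       ≡⟨ cong (λ j → c · column M j) (Fin.punchIn-punchOut (j≢j₀ ∘ sym)) ⟨
    c · column M (punchIn j₀ j')         ≡⟨ ·-comm c _ ⟩
    column M (punchIn j₀ j') · c         ≡⟨ proj₂ (proj₂ orth) j' ⟩
    𝟘                                    ∎
    where
    open ≡-Reasoning
    j' = punchOut (j≢j₀ ∘ sym)
  cM⊥h : h · (c ✕ M) ≡ 𝟘
  cM⊥h = trans (·-comm h (c ✕ M)) (trans (✕-· c M h) (trans (cong (c ·_) Mh≡0) (·-zeroʳ c)))
  cM≡0 : ∀ j → lookup (c ✕ M) j ≡ 𝟘
  cM≡0 j with j Fin.≟ j₀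
  ... | no j≢j₀ = cM≡0-off-j₀ j j≢j₀
  ... | yes refl = ⊗≡𝟘⇒≡𝟘 _ _ hⱼ₀≢0 (trans (sym (·-supported h (c ✕ M) j₀ cM≡0-off-j₀)) cM⊥h)

dependent-on-rows⇒∈C : ∀ {n k} (C : Code n k) x c₀ c' → c₀ ∷ c' ≢ 0w (suc k) →
  (c₀ ∷ c') ✕ (x ∷ gen C) ≡ 0w n → x ∈C C
dependent-on-rows⇒∈C C x c₀ c' c≢0 c✕xG≡0 with c₀ ≟F 𝟘
... | yes refl = ⊥-elim (c≢0 (cong (𝟘 ∷_) (indep C c' (begin
  c' ✕ gen C                      ≡⟨ +ᵥ-identityˡ (c' ✕ gen C) ⟨
  0w _ +ᵥ c' ✕ gen C              ≡⟨ cong (_+ᵥ c' ✕ gen C) (𝟘• x) ⟨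
  𝟘 • x +ᵥ c' ✕ gen C             ≡⟨ ∷✕∷ 𝟘 c' x (gen C) ⟨
  (𝟘 ∷ c') ✕ (x ∷ gen C)          ≡⟨ c✕xG≡0 ⟩
  0w _                            ∎))))
  where open ≡-Reasoning
... | no c₀≢0 = (- c₀) • c' , (begin
  ((- c₀) • c') ✕ gen C           ≡⟨ •✕ (- c₀) c' (gen C) ⟩
  (- c₀) • (c' ✕ gen C)           ≡⟨ •+ᵥ≡0w⇒ c₀ x (c' ✕ gen C) c₀≢0
                                       (trans (sym (∷✕∷ c₀ c' x (gen C))) c✕xG≡0) ⟨
  x                               ∎)
  where open ≡-Reasoning

HasCheckVector : ∀ {n k} → Code n k → Word n → Set
HasCheckVector C h = ∀ x → (x ∈C C) ⇔ (x · h ≡ 𝟘)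

hyperplane-check : ∀ {n} (C : Code (suc n) n) → ∃ λ h → h ≢ 0w (suc n) × HasCheckVector C h
hyperplane-check {n} C = h , h≢0 , λ x → mk⇔ (∈C⇒⊥h x) (⊥h⇒∈C x)
  where
  G = gen C
  orth = nonzero-orthogonal (ℕ.n<1+n n) (lookup G)
  h = proj₁ orth
  h≢0 = proj₁ (proj₂ orth)
  Gh≡0 : G ⊙ h ≡ 0w n
  Gh≡0 = lookup-ext λ i → trans (Vec.lookup∘tabulate _ i) (trans (proj₂ (proj₂ orth) i) (sym (lookup-0w i)))
  ∈C⇒⊥h : ∀ x → x ∈C C → x · h ≡ 𝟘
  ∈C⇒⊥h x (m , refl) = trans (✕-· m G h) (trans (cong (m ·_) Gh≡0) (·-zeroʳ m))
  ⊥h⇒∈C : ∀ x → x · h ≡ 𝟘 → x ∈C C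
  ⊥h⇒∈C x x⊥h with orthogonal-rows⇒dependent (x ∷ G) h h≢0 (cong₂ _∷_ x⊥h Gh≡0)
  ... | c₀ ∷ c' , c≢0 , c✕xG≡0 = dependent-on-rows⇒∈C C x c₀ c' c≢0 c✕xG≡0

fromℕ : ℕ → F3
fromℕ 0                   = 𝟘
fromℕ 1                   = 𝟙
fromℕ 2                   = 𝟚
fromℕ (suc (suc (suc n))) = fromℕ n

fromℕ-suc : ∀ n → fromℕ (suc n) ≡ 𝟙 ⊕ fromℕ n
fromℕ-suc 0                   = refl
fromℕ-suc 1                   = refl
fromℕ-suc 2                   = refl
fromℕ-suc (suc (suc (suc n))) = fromℕ-suc n

·-self : ∀ {n} (x : Word n) → x · x ≡ fromℕ (wt x)
·-self []      = refl
·-self (𝟘 ∷ x) = ·-self x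
·-self (𝟙 ∷ x) = trans (cong (𝟙 ⊕_) (·-self x)) (sym (fromℕ-suc (wt x)))
·-self (𝟚 ∷ x) = trans (cong (𝟙 ⊕_) (·-self x)) (sym (fromℕ-suc (wt x)))

wt-0w : ∀ n → wt (0w n) ≡ 0
wt-0w zero    = refl
wt-0w (suc n) = wt-0w n

wt≡0⇒≡0w : ∀ {n} (x : Word n) → wt x ≡ 0 → x ≡ 0w n
wt≡0⇒≡0w []      _  = refl
wt≡0⇒≡0w (𝟘 ∷ x) eq = cong (𝟘 ∷_) (wt≡0⇒≡0w x eq)

≢0w⇒1≤wt : ∀ {n} (x : Word n) → x ≢ 0w n → 1 ≤ wt x
≢0w⇒1≤wt x x≢0 with wt x in eq
... | zero  = ⊥-elim (x≢0 (wt≡0⇒≡0w x eq))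
... | suc _ = s≤s z≤n

1≤wt⇒≢0w : ∀ {n} (x : Word n) → 1 ≤ wt x → x ≢ 0w n
1≤wt⇒≢0w {n} x 1≤wt refl = ℕ.<⇒≢ 1≤wt (sym (wt-0w n))

wt≤n : ∀ {n} (x : Word n) → wt x ≤ n
wt≤n []      = z≤n
wt≤n (𝟘 ∷ x) = ℕ.m≤n⇒m≤1+n (wt≤n x)
wt≤n (𝟙 ∷ x) = s≤s (wt≤n x)
wt≤n (𝟚 ∷ x) = s≤s (wt≤n x)

wt-• : ∀ {n} a (x : Word n) → a ≢ 𝟘 → wt (a • x) ≡ wt x
wt-• a x a≢0 = trans (wt-as-sum (a • x)) (trans (Σℕ.sum-cong-≗ entrywise) (sym (wt-as-sum x)))
  where
  entrywise : ∀ i → isNonzero (lookup (a • x) i) ≡ isNonzero (lookup x i)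
  entrywise i = trans (cong isNonzero (Vec.lookup-map i (a ⊗_) x)) (isNonzero-⊗ a (lookup x i) a≢0)

-- A monomial matrix, as the permutation of its nonzero positions together with their entries.
record SignedPerm (n : ℕ) : Set where
  field
    perm   : Permutation n n
    sign   : Fin n → F3
    sign≢𝟘 : ∀ i → sign i ≢ 𝟘
open SignedPerm

act : ∀ {n} → SignedPerm n → Word n → Word n
act p x = tabulate (λ j → sign p (perm p ⟨$⟩ˡ j) ⊗ lookup x (perm p ⟨$⟩ˡ j))

lookup-act : ∀ {n} (p : SignedPerm n) x j →
  lookup (act p x) j ≡ sign p (perm p ⟨$⟩ˡ j) ⊗ lookup x (perm p ⟨$⟩ˡ j)
lookup-act p x j = Vec.lookup∘tabulate (λ j → sign p (perm p ⟨$⟩ˡ j) ⊗ lookup x (perm p ⟨$⟩ˡ j)) j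

lookup-act-perm : ∀ {n} (p : SignedPerm n) x i → lookup (act p x) (perm p ⟨$⟩ʳ i) ≡ sign p i ⊗ lookup x i
lookup-act-perm p x i =
  trans (lookup-act p x (perm p ⟨$⟩ʳ i)) (cong (λ k → sign p k ⊗ lookup x k) (Perm.inverseˡ (perm p)))

act-unique : ∀ {n} (p : SignedPerm n) x y →
  (∀ i → lookup y (perm p ⟨$⟩ʳ i) ≡ sign p i ⊗ lookup x i) → act p x ≡ y
act-unique p x y hyp = lookup-ext λ j →
  trans (lookup-act p x j) (trans (sym (hyp (perm p ⟨$⟩ˡ j))) (cong (lookup y) (Perm.inverseʳ (perm p))))

wt-act : ∀ {n} (p : SignedPerm n) x → wt (act p x) ≡ wt x
wt-act p x = begin
  wt (act p x)                                             ≡⟨ wt-as-sum (act p x) ⟩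
  Σℕ.sum (λ j → isNonzero (lookup (act p x) j))            ≡⟨ Σℕ.sum-cong-≗ entrywise ⟩
  Σℕ.sum (λ j → isNonzero (lookup x (perm p ⟨$⟩ˡ j)))       ≡⟨ Σℕ.sum-permute (isNonzero ∘ lookup x) (Perm.flip (perm p)) ⟨
  Σℕ.sum (λ i → isNonzero (lookup x i))                    ≡⟨ wt-as-sum x ⟨
  wt x                                                     ∎
  where
  open ≡-Reasoning
  entrywise : ∀ j → isNonzero (lookup (act p x) j) ≡ isNonzero (lookup x (perm p ⟨$⟩ˡ j))
  entrywise j = trans (cong isNonzero (lookup-act p x j)) (isNonzero-⊗ _ _ (sign≢𝟘 p _))

·-act : ∀ {n} (p : SignedPerm n) x y → act p x · act p y ≡ x · y
·-act p x y = begin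
  act p x · act p y                                          ≡⟨ ·-as-sum (act p x) (act p y) ⟩
  ΣF.sum (λ j → lookup (act p x) j ⊗ lookup (act p y) j)     ≡⟨ ΣF.sum-cong-≗ entrywise ⟩
  ΣF.sum (λ j → lookup x (σ⁻¹ j) ⊗ lookup y (σ⁻¹ j))         ≡⟨ ΣF.sum-permute (λ i → lookup x i ⊗ lookup y i)
                                                                                  (Perm.flip (perm p)) ⟨
  ΣF.sum (λ i → lookup x i ⊗ lookup y i)                     ≡⟨ ·-as-sum x y ⟨
  x · y                                                      ∎
  where
  open ≡-Reasoning
  σ⁻¹ = perm p ⟨$⟩ˡ_
  scaled : ∀ c a b → c ≢ 𝟘 → (c ⊗ a) ⊗ (c ⊗ b) ≡ a ⊗ b
  scaled = from-yes (∀F? λ c → ∀F? λ a → ∀F? λ b →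
    ¬? (c ≟F 𝟘) →-dec ((c ⊗ a) ⊗ (c ⊗ b) ≟F a ⊗ b))
  entrywise : ∀ j → lookup (act p x) j ⊗ lookup (act p y) j ≡ lookup x (σ⁻¹ j) ⊗ lookup y (σ⁻¹ j)
  entrywise j = trans (cong₂ _⊗_ (lookup-act p x j) (lookup-act p y j)) (scaled _ _ _ (sign≢𝟘 p _))

inverse : ∀ {n} → SignedPerm n → SignedPerm n
inverse p = record
  { perm = Perm.flip (perm p) ; sign = λ j → sign p (perm p ⟨$⟩ˡ j) ; sign≢𝟘 = λ j → sign≢𝟘 p _ }

act-inverse : ∀ {n} (p : SignedPerm n) y → act p (act (inverse p) y) ≡ y
act-inverse p y = act-unique p (act (inverse p) y) y λ i → sym (begin
  sign p i ⊗ lookup (act (inverse p) y) i             ≡⟨ cong (sign p i ⊗_) (lookup-act (inverse p) y i) ⟩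
  sign p i ⊗ (sign p (σ⁻¹ (σ i)) ⊗ lookup y (σ i))    ≡⟨ cong (λ k → sign p i ⊗ (sign p k ⊗ lookup y (σ i)))
                                                           (Perm.inverseˡ (perm p)) ⟩
  sign p i ⊗ (sign p i ⊗ lookup y (σ i))              ≡⟨ involutive (sign p i) _ (sign≢𝟘 p i) ⟩
  lookup y (σ i)                                      ∎)
  where
  open ≡-Reasoning
  σ = perm p ⟨$⟩ʳ_
  σ⁻¹ = perm p ⟨$⟩ˡ_
  involutive : ∀ c a → c ≢ 𝟘 → c ⊗ (c ⊗ a) ≡ a
  involutive = from-yes (∀F? λ c → ∀F? λ a → ¬? (c ≟F 𝟘) →-dec (c ⊗ (c ⊗ a) ≟F a))

act-• : ∀ {n} (p : SignedPerm n) c x → act p (c • x) ≡ c • act p x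
act-• p c x = lookup-ext λ j → begin
  lookup (act p (c • x)) j              ≡⟨ lookup-act p (c • x) j ⟩
  sign p (σ⁻¹ j) ⊗ lookup (c • x) (σ⁻¹ j) ≡⟨ cong (sign p (σ⁻¹ j) ⊗_) (Vec.lookup-map (σ⁻¹ j) (c ⊗_) x) ⟩
  sign p (σ⁻¹ j) ⊗ (c ⊗ lookup x (σ⁻¹ j)) ≡⟨ ⊗-left-comm (sign p (σ⁻¹ j)) c (lookup x (σ⁻¹ j)) ⟩
  c ⊗ (sign p (σ⁻¹ j) ⊗ lookup x (σ⁻¹ j)) ≡⟨ cong (c ⊗_) (lookup-act p x j) ⟨
  c ⊗ lookup (act p x) j                ≡⟨ Vec.lookup-map j (c ⊗_) (act p x) ⟨
  lookup (c • act p x) j                ∎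
  where
  open ≡-Reasoning
  σ⁻¹ = perm p ⟨$⟩ˡ_

act-0w : ∀ {n} (p : SignedPerm n) → act p (0w n) ≡ 0w n
act-0w {n} p = trans (cong (act p) (sym (𝟘• (0w n)))) (trans (act-• p 𝟘 (0w n)) (𝟘• (act p (0w n))))

matrix : ∀ {n} → SignedPerm n → Mat n n
matrix p = tabulate (λ i → sign p i • unit (perm p ⟨$⟩ʳ i))

entry-matrix : ∀ {n} (p : SignedPerm n) i j → entry (matrix p) i j ≡ sign p i ⊗ lookup (unit (perm p ⟨$⟩ʳ i)) j
entry-matrix p i j =
  trans (cong (λ r → lookup r j) (Vec.lookup∘tabulate _ i)) (Vec.lookup-map j _ (unit (perm p ⟨$⟩ʳ i)))

entry-matrix-diag : ∀ {n} (p : SignedPerm n) i → entry (matrix p) i (perm p ⟨$⟩ʳ i) ≡ sign p i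
entry-matrix-diag p i =
  trans (entry-matrix p i _) (trans (cong (sign p i ⊗_) (lookup-unit-diag (perm p ⟨$⟩ʳ i))) (⊗-identityʳ _))

entry-matrix-off : ∀ {n} (p : SignedPerm n) i j → perm p ⟨$⟩ʳ i ≢ j → entry (matrix p) i j ≡ 𝟘
entry-matrix-off p i j σi≢j =
  trans (entry-matrix p i j) (trans (cong (sign p i ⊗_) (lookup-unit-off _ j σi≢j)) (⊗-zeroʳ _))

entry-matrix≢𝟘 : ∀ {n} (p : SignedPerm n) i j → entry (matrix p) i j ≢ 𝟘 → perm p ⟨$⟩ʳ i ≡ j
entry-matrix≢𝟘 p i j entry≢0 with perm p ⟨$⟩ʳ i Fin.≟ j
... | yes σi≡j = σi≡j
... | no σi≢j  = ⊥-elim (entry≢0 (entry-matrix-off p i j σi≢j))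

matrix-monomial : ∀ {n} (p : SignedPerm n) → IsMonomial (matrix p)
matrix-monomial p = one-per-row , one-per-column
  where
  σ = perm p ⟨$⟩ʳ_
  σ⁻¹ = perm p ⟨$⟩ˡ_
  diag≢0 : ∀ i → entry (matrix p) i (σ i) ≢ 𝟘
  diag≢0 i = sign≢𝟘 p i ∘ trans (sym (entry-matrix-diag p i))
  one-per-row : ∀ i → ∃ λ j → entry (matrix p) i j ≢ 𝟘 × (∀ j' → entry (matrix p) i j' ≢ 𝟘 → j' ≡ j)
  one-per-row i = σ i , diag≢0 i , λ j' entry≢0 → sym (entry-matrix≢𝟘 p i j' entry≢0)
  one-per-column : ∀ j → ∃ λ i → entry (matrix p) i j ≢ 𝟘 × (∀ i' → entry (matrix p) i' j ≢ 𝟘 → i' ≡ i)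
  one-per-column j =
    σ⁻¹ j , subst (λ k → entry (matrix p) (σ⁻¹ j) k ≢ 𝟘) (Perm.inverseʳ (perm p)) (diag≢0 (σ⁻¹ j)) ,
    λ i' entry≢0 → trans (sym (Perm.inverseˡ (perm p))) (cong σ⁻¹ (entry-matrix≢𝟘 p i' j entry≢0))

✕-monomial : ∀ {n} (P : Mat n n) (p : SignedPerm n) →
  (∀ i → entry P i (perm p ⟨$⟩ʳ i) ≡ sign p i) → (∀ i j → perm p ⟨$⟩ʳ i ≢ j → entry P i j ≡ 𝟘) →
  ∀ x → x ✕ P ≡ act p x
✕-monomial P p diag off x = lookup-ext λ j → begin
  lookup (x ✕ P) j                                   ≡⟨ lookup-✕ x P j ⟩
  x · column P j                                     ≡⟨ ·-supported x (column P j) (σ⁻¹ j) (outside j) ⟩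
  lookup x (σ⁻¹ j) ⊗ lookup (column P j) (σ⁻¹ j)     ≡⟨ cong (lookup x (σ⁻¹ j) ⊗_) (at j) ⟩
  lookup x (σ⁻¹ j) ⊗ sign p (σ⁻¹ j)                  ≡⟨ ⊗-comm (lookup x (σ⁻¹ j)) _ ⟩
  sign p (σ⁻¹ j) ⊗ lookup x (σ⁻¹ j)                  ≡⟨ lookup-act p x j ⟨
  lookup (act p x) j                                 ∎
  where
  open ≡-Reasoning
  σ⁻¹ = perm p ⟨$⟩ˡ_
  outside : ∀ j i → i ≢ σ⁻¹ j → lookup (column P j) i ≡ 𝟘
  outside j i i≢σ⁻¹j = trans (lookup-column P j i)
    (off i j λ σi≡j → i≢σ⁻¹j (trans (sym (Perm.inverseˡ (perm p))) (cong σ⁻¹ σi≡j)))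
  at : ∀ j → lookup (column P j) (σ⁻¹ j) ≡ sign p (σ⁻¹ j)
  at j = trans (lookup-column P j _) (trans (cong (entry P (σ⁻¹ j)) (sym (Perm.inverseʳ (perm p)))) (diag (σ⁻¹ j)))

✕-matrix : ∀ {n} (p : SignedPerm n) x → x ✕ matrix p ≡ act p x
✕-matrix p = ✕-monomial (matrix p) p (entry-matrix-diag p) (entry-matrix-off p)

monomial⇒signedPerm : ∀ {n} (P : Mat n n) → IsMonomial P → ∃ λ p → ∀ x → x ✕ P ≡ act p x
monomial⇒signedPerm {n} P (row , col) = p , ✕-monomial P p (λ _ → refl) off
  where
  σ σ⁻¹ : Fin n → Fin n
  σ i = proj₁ (row i)
  σ⁻¹ j = proj₁ (col j)
  p : SignedPerm n
  p = record
    { perm   = Perm.permutation σ σ⁻¹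
                 (λ j → sym (proj₂ (proj₂ (row (σ⁻¹ j))) j (proj₁ (proj₂ (col j)))))
                 (λ i → sym (proj₂ (proj₂ (col (σ i))) i (proj₁ (proj₂ (row i)))))
    ; sign   = λ i → entry P i (σ i)
    ; sign≢𝟘 = λ i → proj₁ (proj₂ (row i)) }
  off : ∀ i j → σ i ≢ j → entry P i j ≡ 𝟘
  off i j σi≢j with entry P i j ≟F 𝟘
  ... | yes z         = z
  ... | no entry≢0    = ⊥-elim (σi≢j (sym (proj₂ (proj₂ (row i)) j entry≢0)))

MapsOnto : ∀ {n k k'} → SignedPerm n → Code n k → Code n k' → Set
MapsOnto p C C' = ∀ y → (y ∈C C') ⇔ (∃ λ x → x ∈C C × y ≡ act p x)

image-cong : ∀ {n k k'} (C : Code n k) (C' : Code n k') (f g : Word n → Word n) → (∀ x → f x ≡ g x) →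
  (∀ y → (y ∈C C') ⇔ (∃ λ x → x ∈C C × y ≡ f x)) →
  (∀ y → (y ∈C C') ⇔ (∃ λ x → x ∈C C × y ≡ g x))
image-cong C C' f g f≗g image y = mk⇔
  (λ y∈C' → let (x , x∈C , y≡fx) = to (image y) y∈C' in x , x∈C , trans y≡fx (f≗g x))
  (λ (x , x∈C , y≡gx) → from (image y) (x , x∈C , trans y≡gx (sym (f≗g x))))

Equivalent⇒MapsOnto : ∀ {n k k'} (C : Code n k) (C' : Code n k') → Equivalent C C' → ∃ λ p → MapsOnto p C C'
Equivalent⇒MapsOnto C C' (P , P-monomial , image) with monomial⇒signedPerm P P-monomial
... | p , ✕P≗act = p , image-cong C C' (_✕ P) (act p) ✕P≗act image

MapsOnto⇒Equivalent : ∀ {n k k'} (C : Code n k) (C' : Code n k') (p : SignedPerm n) →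
  MapsOnto p C C' → Equivalent C C'
MapsOnto⇒Equivalent C C' p image =
  matrix p , matrix-monomial p , image-cong C C' (act p) (_✕ matrix p) (sym ∘ ✕-matrix p) image

-- The word 𝟙ʷ 𝟘ⁿ⁻ʷ (for w > n it is junk, 𝟙ⁿ).
canonical : (n w : ℕ) → Word n
canonical zero    w       = []
canonical (suc n) zero    = 𝟘 ∷ canonical n zero
canonical (suc n) (suc w) = 𝟙 ∷ canonical n w

wt-canonical : ∀ n w → w ≤ n → wt (canonical n w) ≡ w
wt-canonical zero    zero    _         = refl
wt-canonical (suc n) zero    _         = wt-canonical n zero z≤n
wt-canonical (suc n) (suc w) (s≤s w≤n) = cong suc (wt-canonical n w w≤n)

canonical-full : ∀ n → canonical n n ≡ replicate n 𝟙
canonical-full zero    = refl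
canonical-full (suc n) = cong (𝟙 ∷_) (canonical-full n)

lookup-canonical-at : ∀ n w (w<1+n : w < suc n) → lookup (canonical (suc n) w) (fromℕ< w<1+n) ≡ 𝟘
lookup-canonical-at n       zero    _               = refl
lookup-canonical-at (suc n) (suc w) (s≤s w<1+n) = lookup-canonical-at n w w<1+n

lookup-canonical-punchIn : ∀ n w (w<1+n : w < suc n) j →
  lookup (canonical (suc n) w) (punchIn (fromℕ< w<1+n) j) ≡ lookup (canonical n w) j
lookup-canonical-punchIn (suc n) zero    _           j       = refl
lookup-canonical-punchIn (suc n) (suc w) (s≤s w<1+n) zero    = refl
lookup-canonical-punchIn (suc n) (suc w) (s≤s w<1+n) (suc j) = lookup-canonical-punchIn n w w<1+n j

-- Nonzero entries are normalised to 𝟙 and moved to the front, zero entries to the back.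
act-to-canonical : ∀ {n} (x : Word n) → ∃ λ p → act p x ≡ canonical n (wt x)
act-to-canonical [] = record { perm = Perm.id ; sign = λ () ; sign≢𝟘 = λ () } , refl
act-to-canonical {suc n} (a ∷ x) with act-to-canonical x
... | p , px≡canonical = extend a
  where
  nonzero-head : ∀ a → a ≢ 𝟘 → ∃ λ q → act q (a ∷ x) ≡ 𝟙 ∷ canonical n (wt x)
  nonzero-head a a≢0 = q , act-unique q (a ∷ x) _ moved
    where
    q : SignedPerm (suc n)
    q = record
      { perm   = Perm.insert zero zero (perm p)
      ; sign   = λ { zero → a ; (suc i) → sign p i }
      ; sign≢𝟘 = λ { zero → a≢0 ; (suc i) → sign≢𝟘 p i } }
    moved : ∀ i → lookup (𝟙 ∷ canonical n (wt x)) (perm q ⟨$⟩ʳ i) ≡ sign q i ⊗ lookup (a ∷ x) i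
    moved zero    = sym (⊗-self a a≢0)
    moved (suc i) = begin
      lookup (𝟙 ∷ canonical n (wt x)) (perm q ⟨$⟩ʳ suc i)  ≡⟨ cong (lookup (𝟙 ∷ canonical n (wt x)))
                                                                   (Perm.insert-punchIn zero zero (perm p) i) ⟩
      lookup (canonical n (wt x)) (perm p ⟨$⟩ʳ i)          ≡⟨ cong (λ v → lookup v (perm p ⟨$⟩ʳ i)) px≡canonical ⟨
      lookup (act p x) (perm p ⟨$⟩ʳ i)                     ≡⟨ lookup-act-perm p x i ⟩
      sign p i ⊗ lookup x i                                ∎
      where open ≡-Reasoning
  zero-head : ∃ λ q → act q (𝟘 ∷ x) ≡ canonical (suc n) (wt x)
  zero-head = q , act-unique q (𝟘 ∷ x) _ moved
    where
    w<1+n = s≤s (wt≤n x)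
    slot = fromℕ< w<1+n
    q : SignedPerm (suc n)
    q = record
      { perm   = Perm.insert zero slot (perm p)
      ; sign   = λ { zero → 𝟙 ; (suc i) → sign p i }
      ; sign≢𝟘 = λ { zero () ; (suc i) → sign≢𝟘 p i } }
    moved : ∀ i → lookup (canonical (suc n) (wt x)) (perm q ⟨$⟩ʳ i) ≡ sign q i ⊗ lookup (𝟘 ∷ x) i
    moved zero    = lookup-canonical-at n (wt x) w<1+n
    moved (suc i) = begin
      lookup (canonical (suc n) (wt x)) (perm q ⟨$⟩ʳ suc i)           ≡⟨ cong (lookup (canonical (suc n) (wt x)))
                                                                              (Perm.insert-punchIn zero slot (perm p) i) ⟩
      lookup (canonical (suc n) (wt x)) (punchIn slot (perm p ⟨$⟩ʳ i)) ≡⟨ lookup-canonical-punchIn n (wt x) w<1+n (perm p ⟨$⟩ʳ i) ⟩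
      lookup (canonical n (wt x)) (perm p ⟨$⟩ʳ i)                     ≡⟨ cong (λ v → lookup v (perm p ⟨$⟩ʳ i)) px≡canonical ⟨
      lookup (act p x) (perm p ⟨$⟩ʳ i)                                ≡⟨ lookup-act-perm p x i ⟩
      sign p i ⊗ lookup x i                                           ∎
      where open ≡-Reasoning
  extend : ∀ a → ∃ λ q → act q (a ∷ x) ≡ canonical (suc n) (wt (a ∷ x))
  extend 𝟘 = zero-head
  extend 𝟙 = nonzero-head 𝟙 λ ()
  extend 𝟚 = nonzero-head 𝟚 λ ()

MinWeight-resp-Equivalent : ∀ {n k k'} (C : Code n k) (C' : Code n k') {d} →
  Equivalent C C' → MinWeight C d → MinWeight C' d
MinWeight-resp-Equivalent {n} C C' {d} C≈C' (lower , x , x∈C , x≢0 , wt-x) with Equivalent⇒MapsOnto C C' C≈C'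
... | p , image = lower' , act p x , from (image (act p x)) (x , x∈C , refl) , px≢0 , trans (wt-act p x) wt-x
  where
  lower' : ∀ y → y ∈C C' → y ≢ 0w n → d ≤ wt y
  lower' y y∈C' y≢0 with to (image y) y∈C'
  ... | x' , x'∈C , refl = ℕ.≤-trans (lower x' x'∈C x'≢0) (ℕ.≤-reflexive (sym (wt-act p x')))
    where
    x'≢0 : x' ≢ 0w n
    x'≢0 x'≡0 = y≢0 (trans (cong (act p) x'≡0) (act-0w p))
  px≢0 : act p x ≢ 0w n
  px≢0 px≡0 = x≢0 (wt≡0⇒≡0w x (trans (sym (wt-act p x)) (trans (cong wt px≡0) (wt-0w n))))

MinWeight-unique : ∀ {n k} (C : Code n k) {d d'} → MinWeight C d → MinWeight C d' → d ≡ d'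
MinWeight-unique C (lower , x , x∈C , x≢0 , wt-x) (lower' , x' , x'∈C , x'≢0 , wt-x') =
  ℕ.≤-antisym (ℕ.≤-trans (lower x' x'∈C x'≢0) (ℕ.≤-reflexive wt-x'))
              (ℕ.≤-trans (lower' x x∈C x≢0) (ℕ.≤-reflexive wt-x))

generator : ∀ {n} → Code n 1 → Word n
generator C = head (gen C)

gen≡[generator] : ∀ {n} (C : Code n 1) → gen C ≡ generator C ∷ []
gen≡[generator] C with gen C
... | g ∷ [] = refl

[a]✕[g] : ∀ {n} a (g : Word n) → (a ∷ []) ✕ (g ∷ []) ≡ a • g
[a]✕[g] a g = trans (∷✕∷ a [] g []) (trans (cong (a • g +ᵥ_) ([]✕ [])) (+ᵥ-identityʳ (a • g)))

[a]✕gen : ∀ {n} (C : Code n 1) a → (a ∷ []) ✕ gen C ≡ a • generator C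
[a]✕gen C a = trans (cong ((a ∷ []) ✕_) (gen≡[generator] C)) ([a]✕[g] a (generator C))

∈C-dim1⇔ : ∀ {n} (C : Code n 1) x → (x ∈C C) ⇔ (∃ λ a → x ≡ a • generator C)
∈C-dim1⇔ C x = mk⇔
  (λ { ((a ∷ []) , refl) → a , [a]✕gen C a })
  (λ { (a , refl) → (a ∷ []) , [a]✕gen C a })

generator∈C : ∀ {n} (C : Code n 1) → generator C ∈C C
generator∈C C = from (∈C-dim1⇔ C (generator C)) (𝟙 , sym (𝟙• (generator C)))

generator≢0w : ∀ {n} (C : Code n 1) → generator C ≢ 0w n
generator≢0w C g≡0 with indep C (𝟙 ∷ []) (trans ([a]✕gen C 𝟙) (trans (𝟙• (generator C)) g≡0))
... | ()

span : ∀ {n} (g : Word n) → g ≢ 0w n → Code n 1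
span g g≢0 = record
  { gen   = g ∷ []
  ; indep = λ { (a ∷ []) a•g≡0 →
      cong (_∷ []) (•≡0w⇒≡𝟘 a g g≢0 (trans (sym ([a]✕[g] a g)) a•g≡0)) } }

IsLCD-dim1⇒ : ∀ {n} (C : Code n 1) → IsLCD C → generator C · generator C ≢ 𝟘
IsLCD-dim1⇒ C lcd g·g≡0 = generator≢0w C (lcd (generator C) (generator∈C C) g⊥C)
  where
  g⊥C : ∀ y → y ∈C C → generator C · y ≡ 𝟘
  g⊥C y y∈C with to (∈C-dim1⇔ C y) y∈C
  ... | a , refl = trans (·-• a (generator C) (generator C)) (trans (cong (a ⊗_) g·g≡0) (⊗-zeroʳ a))

IsLCD-dim1⇐ : ∀ {n} (C : Code n 1) → generator C · generator C ≢ 𝟘 → IsLCD C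
IsLCD-dim1⇐ C g·g≢0 x x∈C x⊥C with to (∈C-dim1⇔ C x) x∈C
... | a , refl = trans (cong (_• generator C) a≡0) (𝟘• (generator C))
  where
  a≡0 : a ≡ 𝟘
  a≡0 = ⊗≡𝟘⇒≡𝟘 _ a g·g≢0 (trans (⊗-comm _ a)
          (trans (sym (•-· a (generator C) (generator C))) (x⊥C (generator C) (generator∈C C))))

MinWeight-generator : ∀ {n} (C : Code n 1) → MinWeight C (wt (generator C))
MinWeight-generator {n} C = lower , generator C , generator∈C C , generator≢0w C , refl
  where
  lower : ∀ x → x ∈C C → x ≢ 0w n → wt (generator C) ≤ wt x
  lower x x∈C x≢0 with to (∈C-dim1⇔ C x) x∈C
  ... | a , refl with a ≟F 𝟘
  ...   | yes refl = ⊥-elim (x≢0 (𝟘• (generator C)))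
  ...   | no a≢0   = ℕ.≤-reflexive (sym (wt-• a (generator C) a≢0))

Equivalent-span-canonical : ∀ {n} (C : Code n 1) (c≢0 : canonical n (wt (generator C)) ≢ 0w n) →
  Equivalent C (span (canonical n (wt (generator C))) c≢0)
Equivalent-span-canonical {n} C c≢0 with act-to-canonical (generator C)
... | p , pg≡c = MapsOnto⇒Equivalent C (span c c≢0) p λ y → mk⇔
  (λ y∈S → let (a , y≡ac) = to (∈C-dim1⇔ (span c c≢0) y) y∈S in
     a • generator C , from (∈C-dim1⇔ C _) (a , refl) , trans y≡ac (sym (act-generator a)))
  (λ (x , x∈C , y≡px) → let (a , x≡ag) = to (∈C-dim1⇔ C x) x∈C in
     from (∈C-dim1⇔ (span c c≢0) y) (a , trans y≡px (trans (cong (act p) x≡ag) (act-generator a))))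
  where
  c = canonical n (wt (generator C))
  act-generator : ∀ a → act p (a • generator C) ≡ a • c
  act-generator a = trans (act-• p a (generator C)) (cong (a •_) pg≡c)

checkRows : ∀ {n} → Word n → Mat n (suc n)
checkRows h' = tabulate (λ j → - lookup h' j ∷ unit j)

column-tabulate : ∀ {k n} (R : Fin k → Word n) j → column (tabulate R) j ≡ tabulate (λ i → lookup (R i) j)
column-tabulate {zero}  R j = refl
column-tabulate {suc k} R j = cong (lookup (R zero) j ∷_) (column-tabulate (R ∘ suc) j)

lookup-unit-comm : ∀ {n} (i j : Fin n) → lookup (unit j) i ≡ lookup (unit i) j
lookup-unit-comm zero    zero            = refl
lookup-unit-comm {suc n} zero    (suc j) = sym (lookup-0w j)
lookup-unit-comm {suc n} (suc i) zero    = lookup-0w i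
lookup-unit-comm (suc i) (suc j)         = lookup-unit-comm i j

·-negate : ∀ {n} (m h : Word n) → m · tabulate (λ j → - lookup h j) ≡ - (m · h)
·-negate []      []      = refl
·-negate (a ∷ m) (b ∷ h) = trans (cong (a ⊗ - b ⊕_) (·-negate m h)) (negate a b (m · h))
  where
  negate : ∀ a b c → a ⊗ - b ⊕ - c ≡ - (a ⊗ b ⊕ c)
  negate = from-yes (∀F? λ a → ∀F? λ b → ∀F? λ c → a ⊗ - b ⊕ - c ≟F - (a ⊗ b ⊕ c))

✕-checkRows : ∀ {n} (m h' : Word n) → m ✕ checkRows h' ≡ - (m · h') ∷ m
✕-checkRows m h' = lookup-ext λ
  { zero    → trans (lookup-✕ m _ zero) (trans (cong (m ·_) (column-tabulate rows zero)) (·-negate m h'))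
  ; (suc i) → trans (lookup-✕ m _ (suc i)) (trans (cong (m ·_) (column-i i)) (·-unit m i)) }
  where
  rows = λ j → - lookup h' j ∷ unit j
  column-i : ∀ i → column (checkRows h') (suc i) ≡ unit i
  column-i i = trans (column-tabulate rows (suc i))
    (trans (Vec.tabulate-cong (λ j → lookup-unit-comm i j)) (Vec.tabulate∘lookup (unit i)))

hyperplaneCode : ∀ {n} → Word n → Code (suc n) n
hyperplaneCode h' = record
  { gen   = checkRows h'
  ; indep = λ m m✕≡0 → trans (cong tail (sym (✕-checkRows m h'))) (cong tail m✕≡0) }

HasCheckVector-hyperplaneCode : ∀ {n} (h' : Word n) → HasCheckVector (hyperplaneCode h') (𝟙 ∷ h')
HasCheckVector-hyperplaneCode h' x = mk⇔ (∈C⇒⊥ x) (⊥⇒∈C x)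
  where
  ∈C⇒⊥ : ∀ x → x ∈C hyperplaneCode h' → x · (𝟙 ∷ h') ≡ 𝟘
  ∈C⇒⊥ x (m , refl) = trans (cong (_· (𝟙 ∷ h')) (✕-checkRows m h'))
    (trans (cong (_⊕ m · h') (⊗-identityʳ _)) (-‿inverseˡ (m · h')))
  ⊥⇒∈C : ∀ x → x · (𝟙 ∷ h') ≡ 𝟘 → x ∈C hyperplaneCode h'
  ⊥⇒∈C (a ∷ x') x⊥ = x' , trans (✕-checkRows x' h')
    (cong (_∷ x') (sym (⊕≡𝟘⇒≡- a (x' · h') (trans (cong (_⊕ x' · h') (sym (⊗-identityʳ a))) x⊥))))

-- The rows of checkRows h' lie in C, and orthogonality to them pins down z from its head.
⊥-checked⇒multiple : ∀ {n k} (C : Code (suc n) k) (h' : Word n) → HasCheckVector C (𝟙 ∷ h') →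
  ∀ z → (∀ y → y ∈C C → z · y ≡ 𝟘) → z ≡ head z • (𝟙 ∷ h')
⊥-checked⇒multiple C h' check (z₀ ∷ z') z⊥C = lookup-ext λ
  { zero    → sym (⊗-identityʳ z₀)
  ; (suc j) → trans (z'-entry j) (sym (Vec.lookup-map j (z₀ ⊗_) h')) }
  where
  row : ∀ j → Word _
  row j = - lookup h' j ∷ unit j
  row∈C : ∀ j → row j ∈C C
  row∈C j = from (check (row j))
    (trans (cong₂ _⊕_ (⊗-identityʳ _) (trans (·-comm (unit j) h') (·-unit h' j))) (-‿inverseˡ (lookup h' j)))
  solve : ∀ a b c → a ⊗ - b ⊕ c ≡ 𝟘 → c ≡ a ⊗ b
  solve = from-yes (∀F? λ a → ∀F? λ b → ∀F? λ c → (a ⊗ - b ⊕ c ≟F 𝟘) →-dec (c ≟F a ⊗ b))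
  z'-entry : ∀ j → lookup z' j ≡ z₀ ⊗ lookup h' j
  z'-entry j = solve z₀ (lookup h' j) (lookup z' j)
    (trans (cong (z₀ ⊗ - lookup h' j ⊕_) (sym (·-unit z' j))) (z⊥C (row j) (row∈C j)))

IsLCD-checked⇐ : ∀ {n k} (C : Code (suc n) k) (h' : Word n) → HasCheckVector C (𝟙 ∷ h') →
  (𝟙 ∷ h') · (𝟙 ∷ h') ≢ 𝟘 → IsLCD C
IsLCD-checked⇐ C h' check v·v≢0 x x∈C x⊥C = trans x≡x₀v (trans (cong (_• v) x₀≡0) (𝟘• v))
  where
  v = 𝟙 ∷ h'
  x≡x₀v : x ≡ head x • v
  x≡x₀v = ⊥-checked⇒multiple C h' check x x⊥C
  x₀≡0 : head x ≡ 𝟘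
  x₀≡0 = ⊗≡𝟘⇒≡𝟘 _ (head x) v·v≢0 (begin
    (v · v) ⊗ head x      ≡⟨ ⊗-comm _ (head x) ⟩
    head x ⊗ (v · v)      ≡⟨ •-· (head x) v v ⟨
    (head x • v) · v      ≡⟨ cong (_· v) x≡x₀v ⟨
    x · v                 ≡⟨ to (check x) x∈C ⟩
    𝟘                     ∎)
    where open ≡-Reasoning

IsLCD-checked⇒ : ∀ {n k} (C : Code n k) h → h ≢ 0w n → HasCheckVector C h → IsLCD C → h · h ≢ 𝟘
IsLCD-checked⇒ C h h≢0 check lcd h·h≡0 =
  h≢0 (lcd h (from (check h) h·h≡0) λ y y∈C → trans (·-comm h y) (to (check y) y∈C))

Equivalent-checked : ∀ {n k k'} (C : Code n k) (C' : Code n k') h v (p : SignedPerm n) →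
  HasCheckVector C h → HasCheckVector C' v → act p h ≡ v → Equivalent C C'
Equivalent-checked C C' h v p check check' ph≡v = MapsOnto⇒Equivalent C C' p λ y → mk⇔
  (λ y∈C' → act (inverse p) y , from (check _) (begin
      act (inverse p) y · h                   ≡⟨ ·-act p (act (inverse p) y) h ⟨
      act p (act (inverse p) y) · act p h     ≡⟨ cong₂ _·_ (act-inverse p y) ph≡v ⟩
      y · v                                   ≡⟨ to (check' y) y∈C' ⟩
      𝟘                                       ∎)
    , sym (act-inverse p y))
  (λ (x , x∈C , y≡px) → from (check' y) (begin
      y · v                                   ≡⟨ cong₂ _·_ y≡px (sym ph≡v) ⟩
      act p x · act p h                       ≡⟨ ·-act p x h ⟩
      x · h                                   ≡⟨ to (check x) x∈C ⟩
      𝟘                                       ∎))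
  where open ≡-Reasoning

-- Under the equivalence, 𝟙 ∷ h is carried to a vector orthogonal to C', hence to a nonzero
-- multiple of 𝟙 ∷ h'.
wt-check-invariant : ∀ {n k} (C C' : Code (suc n) k) (h h' : Word n) → Equivalent C C' →
  HasCheckVector C (𝟙 ∷ h) → HasCheckVector C' (𝟙 ∷ h') → wt (𝟙 ∷ h) ≡ wt (𝟙 ∷ h')
wt-check-invariant C C' h h' C≈C' check check' with Equivalent⇒MapsOnto C C' C≈C'
... | p , image = begin
  wt (𝟙 ∷ h)                  ≡⟨ wt-act p (𝟙 ∷ h) ⟨
  wt u                        ≡⟨ cong wt u≡u₀v ⟩
  wt (head u • (𝟙 ∷ h'))      ≡⟨ wt-• (head u) (𝟙 ∷ h') u₀≢0 ⟩
  wt (𝟙 ∷ h')                 ∎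
  where
  open ≡-Reasoning
  u = act p (𝟙 ∷ h)
  u⊥C' : ∀ y → y ∈C C' → u · y ≡ 𝟘
  u⊥C' y y∈C' with to (image y) y∈C'
  ... | x , x∈C , refl = trans (·-act p (𝟙 ∷ h) x) (trans (·-comm (𝟙 ∷ h) x) (to (check x) x∈C))
  u≡u₀v : u ≡ head u • (𝟙 ∷ h')
  u≡u₀v = ⊥-checked⇒multiple C' h' check' u u⊥C'
  u₀≢0 : head u ≢ 𝟘
  u₀≢0 u₀≡0 = 1≤wt⇒≢0w u (subst (1 ≤_) (sym (wt-act p (𝟙 ∷ h))) (s≤s z≤n))
    (trans u≡u₀v (trans (cong (_• (𝟙 ∷ h')) u₀≡0) (𝟘• (𝟙 ∷ h'))))

wt-unit : ∀ {n} (j : Fin n) → wt (unit j) ≡ 1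
wt-unit {suc n} zero = cong suc (wt-0w n)
wt-unit (suc j)      = wt-unit j

wt≡1⇒·𝟙ⁿ≢𝟘 : ∀ {n} (y : Word n) → wt y ≡ 1 → y · replicate n 𝟙 ≢ 𝟘
wt≡1⇒·𝟙ⁿ≢𝟘 (𝟘 ∷ y) wt≡1 = wt≡1⇒·𝟙ⁿ≢𝟘 y wt≡1
wt≡1⇒·𝟙ⁿ≢𝟘 {suc n} (𝟙 ∷ y) wt≡1
  rewrite wt≡0⇒≡0w y (ℕ.suc-injective wt≡1) | ·-zeroˡ (replicate n 𝟙) = λ ()
wt≡1⇒·𝟙ⁿ≢𝟘 {suc n} (𝟚 ∷ y) wt≡1
  rewrite wt≡0⇒≡0w y (ℕ.suc-injective wt≡1) | ·-zeroˡ (replicate n 𝟙) = λ ()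

MinWeight-hyperplane-< : ∀ n w → w < n → MinWeight (hyperplaneCode (canonical n w)) 1
MinWeight-hyperplane-< (suc n) w w<1+n =
  (λ x _ x≢0 → ≢0w⇒1≤wt x x≢0) ,
  𝟘 ∷ unit slot ,
  from (HasCheckVector-hyperplaneCode (canonical (suc n) w) (𝟘 ∷ unit slot))
    (trans (·-comm (unit slot) _) (trans (·-unit (canonical (suc n) w) slot) (lookup-canonical-at n w w<1+n))) ,
  1≤wt⇒≢0w (𝟘 ∷ unit slot) (ℕ.≤-reflexive (sym (wt-unit slot))) ,
  wt-unit slot
  where
  slot = fromℕ< w<1+n

-- With the all-ones check vector every weight-one word is excluded, and 𝟙𝟚0… is in the code.
MinWeight-hyperplane-full : ∀ n → MinWeight (hyperplaneCode (canonical (suc n) (suc n))) 2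
MinWeight-hyperplane-full n =
  lower , y , from (check y) y⊥ , 1≤wt⇒≢0w y (s≤s z≤n) , cong (λ k → suc (suc k)) (wt-0w n)
  where
  check = HasCheckVector-hyperplaneCode (canonical (suc n) (suc n))
  y : Word (suc (suc n))
  y = 𝟙 ∷ 𝟚 ∷ 0w n
  y⊥ : y · (𝟙 ∷ canonical (suc n) (suc n)) ≡ 𝟘
  y⊥ = cong (λ t → 𝟙 ⊕ (𝟚 ⊕ t)) (·-zeroˡ (canonical n n))
  lower : ∀ x → x ∈C hyperplaneCode (canonical (suc n) (suc n)) → x ≢ 0w (suc (suc n)) → 2 ≤ wt x
  lower x x∈C x≢0 with wt x in wt≡ | ≢0w⇒1≤wt x x≢0
  ... | suc zero    | _ = ⊥-elim (wt≡1⇒·𝟙ⁿ≢𝟘 x wt≡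
          (trans (cong (x ·_) (sym (canonical-full (suc (suc n))))) (to (check x) x∈C)))
  ... | suc (suc _) | _ = s≤s (s≤s z≤n)

ValidWeight : ℕ → ℕ → Set
ValidWeight n w = 1 ≤ w × w ≤ n × fromℕ w ≢ 𝟘

#validWeights : ℕ → ℕ
#validWeights zero    = 0
#validWeights (suc n) = isNonzero (fromℕ (suc n)) + #validWeights n

-- Of any three consecutive weights exactly two are not multiples of 3.
#validWeights-+3 : ∀ n → #validWeights (3 + n) ≡ 2 + #validWeights n
#validWeights-+3 n rewrite fromℕ-suc (suc n) | fromℕ-suc n with fromℕ n
... | 𝟘 = refl
... | 𝟙 = refl
... | 𝟚 = refl

+-suc³ : ∀ r x → r + (3 + x) ≡ 3 + (r + x)
+-suc³ = solve-∀

#validWeights-+3q : ∀ r q → #validWeights (r + q * 3) ≡ #validWeights r + q * 2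
#validWeights-+3q r zero    = trans (cong #validWeights (ℕ.+-identityʳ r)) (sym (ℕ.+-identityʳ _))
#validWeights-+3q r (suc q) = begin
  #validWeights (r + (3 + q * 3))       ≡⟨ cong #validWeights (+-suc³ r (q * 3)) ⟩
  #validWeights (3 + (r + q * 3))       ≡⟨ #validWeights-+3 (r + q * 3) ⟩
  2 + #validWeights (r + q * 3)         ≡⟨ cong (2 +_) (#validWeights-+3q r q) ⟩
  2 + (#validWeights r + q * 2)         ≡⟨ shift (#validWeights r) (q * 2) ⟩
  #validWeights r + (2 + q * 2)         ∎
  where
  open ≡-Reasoning
  shift : ∀ a b → 2 + (a + b) ≡ a + (2 + b)
  shift = solve-∀

fromℕ-+3q : ∀ r q → fromℕ (r + q * 3) ≡ fromℕ r
fromℕ-+3q r zero    = cong fromℕ (ℕ.+-identityʳ r)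
fromℕ-+3q r (suc q) = trans (cong fromℕ (+-suc³ r (q * 3))) (fromℕ-+3q r q)

data Mod3 (n : ℕ) : Set where
  rem0 : ∀ q → n ≡ 0 + q * 3 → n % 3 ≡ 0 → Mod3 n
  rem1 : ∀ q → n ≡ 1 + q * 3 → n % 3 ≡ 1 → Mod3 n
  rem2 : ∀ q → n ≡ 2 + q * 3 → n % 3 ≡ 2 → Mod3 n

mod3 : ∀ n → Mod3 n
mod3 n with n % 3 in eq | m≡m%n+[m/n]*n n 3 | m%n<n n 3
... | 0                 | n≡ | _ = rem0 (n / 3) n≡ eq
... | 1                 | n≡ | _ = rem1 (n / 3) n≡ eq
... | 2                 | n≡ | _ = rem2 (n / 3) n≡ eq
... | suc (suc (suc _)) | _  | s≤s (s≤s (s≤s ()))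

valI≡isNonzero : ∀ d → valI d ≡ isNonzero (fromℕ d)
valI≡isNonzero d with mod3 d
... | rem0 q refl eq rewrite eq | fromℕ-+3q 0 q = refl
... | rem1 q refl eq rewrite eq | fromℕ-+3q 1 q = refl
... | rem2 q refl eq rewrite eq | fromℕ-+3q 2 q = refl

twoThirds-3q+r : ∀ r q → (2 * (r + q * 3) + r) / 3 ≡ r + q * 2
twoThirds-3q+r r q = trans (cong (_/ 3) (identity r q)) (m*n/n≡m (r + q * 2) 3)
  where
  identity : ∀ r q → 2 * (r + q * 3) + r ≡ (r + q * 2) * 3
  identity = solve-∀

valII≡#validWeights : ∀ n → valII n ≡ #validWeights n
valII≡#validWeights n with mod3 n
... | rem0 q refl eq rewrite eq =
  trans (cong (_/ 3) (sym (ℕ.+-identityʳ (2 * (q * 3))))) (trans (twoThirds-3q+r 0 q) (sym (#validWeights-+3q 0 q)))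
... | rem1 q refl eq rewrite eq = trans (twoThirds-3q+r 1 q) (sym (#validWeights-+3q 1 q))
... | rem2 q refl eq rewrite eq = trans (twoThirds-3q+r 2 q) (sym (#validWeights-+3q 2 q))

valIII-1≡#validWeights : ∀ n → 2 ≤ n → valIII n 1 ≡ #validWeights (n ∸ 1)
valIII-1≡#validWeights n 2≤n with mod3 n
... | rem0 zero    refl eq = ⊥-elim (ℕ.<⇒≱ (s≤s z≤n) 2≤n)
... | rem0 (suc q) refl eq rewrite eq =
  trans (cong (_/ 3) (sym (ℕ.+-identityʳ (2 * (suc q * 3)))))
        (trans (twoThirds-3q+r 0 (suc q)) (sym (#validWeights-+3q 2 q)))
... | rem1 q       refl eq rewrite eq = trans (cong (_∸ 1) (twoThirds-3q+r 1 q)) (sym (#validWeights-+3q 0 q))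
... | rem2 q       refl eq rewrite eq = trans (cong (_∸ 1) (twoThirds-3q+r 2 q)) (sym (#validWeights-+3q 1 q))

valIII-2≡isNonzero : ∀ n → valIII n 2 ≡ isNonzero (fromℕ n)
valIII-2≡isNonzero n with mod3 n
... | rem0 q refl eq rewrite eq | fromℕ-+3q 0 q = refl
... | rem1 q refl eq rewrite eq | fromℕ-+3q 1 q = refl
... | rem2 q refl eq rewrite eq | fromℕ-+3q 2 q = refl

valIII-0 : ∀ n → valIII n 0 ≡ 0
valIII-0 n with mod3 n
... | rem0 q refl eq rewrite eq = refl
... | rem1 q refl eq rewrite eq = refl
... | rem2 q refl eq rewrite eq = refl

valIII-3+ : ∀ n d → valIII n (3 + d) ≡ 0
valIII-3+ n d with mod3 n
... | rem0 q refl eq rewrite eq = refl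
... | rem1 q refl eq rewrite eq = refl
... | rem2 q refl eq rewrite eq = refl

record Enumeration (A : ℕ → Set) (N : ℕ) : Set where
  field
    value           : Fin N → ℕ
    value∈A         : ∀ i → A (value i)
    value-injective : ∀ i j → value i ≡ value j → i ≡ j
    value-onto      : ∀ w → A w → ∃ λ i → value i ≡ w
open Enumeration

Enumeration-resp : ∀ {A B : ℕ → Set} {N} → (∀ w → A w → B w) → (∀ w → B w → A w) →
  Enumeration A N → Enumeration B N
Enumeration-resp A⇒B B⇒A E = record
  { value = value E ; value∈A = λ i → A⇒B _ (value∈A E i)
  ; value-injective = value-injective E ; value-onto = λ w b → value-onto E w (B⇒A w b) }

Enumeration-∅ : ∀ {A : ℕ → Set} → (∀ w → ¬ A w) → Enumeration A 0
Enumeration-∅ ¬A = record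
  { value = λ () ; value∈A = λ () ; value-injective = λ () ; value-onto = λ w a → ⊥-elim (¬A w a) }

Enumeration-singleton : ∀ {A : ℕ → Set} w₀ → A w₀ → (∀ w → A w → w ≡ w₀) → Enumeration A 1
Enumeration-singleton w₀ a₀ unique = record
  { value = λ _ → w₀ ; value∈A = λ { zero → a₀ }
  ; value-injective = λ { zero zero _ → refl } ; value-onto = λ w a → zero , sym (unique w a) }

Enumeration-insert : ∀ {A B : ℕ → Set} {N} w₀ → B w₀ → ¬ A w₀ → (∀ w → A w → B w) →
  (∀ w → B w → A w ⊎ w ≡ w₀) → Enumeration A N → Enumeration B (suc N)
Enumeration-insert {A} {B} {N} w₀ b₀ ¬a₀ A⇒B B⇒A⊎w₀ E = record
  { value = value' ; value∈A = value'∈B ; value-injective = injective ; value-onto = onto }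
  where
  value' : Fin (suc N) → ℕ
  value' zero    = w₀
  value' (suc i) = value E i
  value'∈B : ∀ i → B (value' i)
  value'∈B zero    = b₀
  value'∈B (suc i) = A⇒B _ (value∈A E i)
  injective : ∀ i j → value' i ≡ value' j → i ≡ j
  injective zero    zero    _  = refl
  injective zero    (suc j) eq = ⊥-elim (¬a₀ (subst A (sym eq) (value∈A E j)))
  injective (suc i) zero    eq = ⊥-elim (¬a₀ (subst A eq (value∈A E i)))
  injective (suc i) (suc j) eq = cong suc (value-injective E i j eq)
  onto : ∀ w → B w → ∃ λ i → value' i ≡ w
  onto w b with B⇒A⊎w₀ w b
  ... | inj₁ a    = let (i , eq) = value-onto E w a in suc i , eq
  ... | inj₂ refl = zero , refl

isNonzero-≢𝟘 : ∀ a → a ≢ 𝟘 → isNonzero a ≡ 1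
isNonzero-≢𝟘 = from-yes (∀F? λ a → ¬? (a ≟F 𝟘) →-dec (isNonzero a ℕ.≟ 1))

ValidWeight-weaken : ∀ {n} w → ValidWeight n w → ValidWeight (suc n) w
ValidWeight-weaken w (1≤w , w≤n , w≢0) = 1≤w , ℕ.m≤n⇒m≤1+n w≤n , w≢0

ValidWeight-suc⇒ : ∀ {n} w → ValidWeight (suc n) w → ValidWeight n w ⊎ w ≡ suc n
ValidWeight-suc⇒ w (1≤w , w≤n+1 , w≢0) with ℕ.m≤n⇒m<n∨m≡n w≤n+1
... | inj₁ w<n+1 = inj₁ (1≤w , ℕ.≤-pred w<n+1 , w≢0)
... | inj₂ w≡n+1 = inj₂ w≡n+1

validWeights : ∀ n → Enumeration (ValidWeight n) (#validWeights n)
validWeights zero    = Enumeration-∅ λ { w (1≤w , w≤0 , _) → ℕ.<⇒≱ 1≤w w≤0 }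
validWeights (suc n) with fromℕ (suc n) ≟F 𝟘
... | yes n+1≡0 rewrite n+1≡0 = Enumeration-resp ValidWeight-weaken strengthen (validWeights n)
  where
  strengthen : ∀ w → ValidWeight (suc n) w → ValidWeight n w
  strengthen w v with ValidWeight-suc⇒ w v
  ... | inj₁ v'   = v'
  ... | inj₂ refl = ⊥-elim (proj₂ (proj₂ v) n+1≡0)
... | no n+1≢0 = subst (Enumeration (ValidWeight (suc n))) (cong (_+ #validWeights n) (sym (isNonzero-≢𝟘 _ n+1≢0)))
  (Enumeration-insert (suc n) (s≤s z≤n , ℕ.≤-refl , n+1≢0) (λ (_ , n+1≤n , _) → ℕ.<-irrefl refl n+1≤n)
    ValidWeight-weaken ValidWeight-suc⇒ (validWeights n))

representatives : ∀ {n k} {Q : Code n k → Set} {A : ℕ → Set} {N} → Enumeration A N →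
  (R : ∀ w → A w → Code n k) → (∀ w a → Q (R w a)) →
  (I : Code n k → ℕ → Set) → (∀ w a → I (R w a) w) →
  (∀ C C' {w w'} → Equivalent C C' → I C w → I C' w' → w ≡ w') →
  (∀ C → Q C → ∃ λ w → A w × (∀ a → Equivalent C (R w a))) →
  Representatives n k Q N
representatives E R R-Q I I-R I-invariant classify = record
  { rep      = λ i → R (value E i) (value∈A E i)
  ; rep-Q    = λ i → R-Q (value E i) (value∈A E i)
  ; distinct = λ i j Rᵢ≈Rⱼ → value-injective E i j (I-invariant _ _ Rᵢ≈Rⱼ (I-R _ _) (I-R _ _))
  ; complete = λ C q → let (w , a , C≈R) = classify C q ; (i , eq) = value-onto E w a in
      i , subst (λ w → ∀ a → Equivalent C (R w a)) (sym eq) C≈R (value∈A E i) }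

canonical≢0w : ∀ {n w} → ValidWeight n w → canonical n w ≢ 0w n
canonical≢0w {n} {w} (1≤w , w≤n , _) = 1≤wt⇒≢0w _ (subst (1 ≤_) (sym (wt-canonical n w w≤n)) 1≤w)

canonical·canonical≢𝟘 : ∀ {n w} → ValidWeight n w → canonical n w · canonical n w ≢ 𝟘
canonical·canonical≢𝟘 {n} {w} (_ , w≤n , w≢0) c·c≡0 =
  w≢0 (trans (sym (trans (·-self (canonical n w)) (cong fromℕ (wt-canonical n w w≤n)))) c·c≡0)

lineCode : ∀ n w → ValidWeight n w → Code n 1
lineCode n w v = span (canonical n w) (canonical≢0w v)

IsLCD-lineCode : ∀ n w (v : ValidWeight n w) → IsLCD (lineCode n w v)
IsLCD-lineCode n w v = IsLCD-dim1⇐ (lineCode n w v) (canonical·canonical≢𝟘 v)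

MinWeight-lineCode : ∀ n w (v : ValidWeight n w) → MinWeight (lineCode n w v) w
MinWeight-lineCode n w v =
  subst (MinWeight (lineCode n w v)) (wt-canonical n w (proj₁ (proj₂ v))) (MinWeight-generator (lineCode n w v))

MinWeight-invariant : ∀ {n k} (C C' : Code n k) {w w'} →
  Equivalent C C' → MinWeight C w → MinWeight C' w' → w ≡ w'
MinWeight-invariant C C' C≈C' mw mw' = MinWeight-unique C' (MinWeight-resp-Equivalent C C' C≈C' mw) mw'

LCD-dim1-classify : ∀ {n} (C : Code n 1) → IsLCD C →
  ∃ λ w → ValidWeight n w × MinWeight C w × (∀ v → Equivalent C (lineCode n w v))
LCD-dim1-classify {n} C lcd =
  wt g , (≢0w⇒1≤wt g (generator≢0w C) , wt≤n g , IsLCD-dim1⇒ C lcd ∘ trans (·-self g)) ,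
  MinWeight-generator C , λ v → Equivalent-span-canonical C (canonical≢0w v)
  where
  g = generator C

NumLCDd-dim1 : ∀ n d → 1 ≤ d → d ≤ n → NumLCDd n 1 d (valI d)
NumLCDd-dim1 n d 1≤d d≤n = representatives weights (λ w a → lineCode n w (proj₁ a)) R-Q
  MinWeight (λ w a → MinWeight-lineCode n w (proj₁ a)) MinWeight-invariant classify
  where
  A : ℕ → Set
  A w = ValidWeight n w × w ≡ d
  weights : Enumeration A (valI d)
  weights with fromℕ d ≟F 𝟘
  ... | yes d≡0 = subst (Enumeration A) (sym (trans (valI≡isNonzero d) (cong isNonzero d≡0)))
    (Enumeration-∅ λ { w ((_ , _ , w≢0) , refl) → w≢0 d≡0 })
  ... | no d≢0  = subst (Enumeration A) (sym (trans (valI≡isNonzero d) (isNonzero-≢𝟘 _ d≢0)))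
    (Enumeration-singleton d ((1≤d , d≤n , d≢0) , refl) λ w → proj₂)
  R-Q : ∀ w (a : A w) → IsLCD (lineCode n w (proj₁ a)) × MinWeight (lineCode n w (proj₁ a)) d
  R-Q w (v , refl) = IsLCD-lineCode n w v , MinWeight-lineCode n w v
  classify : ∀ C → IsLCD C × MinWeight C d → ∃ λ w → A w × (∀ a → Equivalent C (lineCode n w (proj₁ a)))
  classify C (lcd , mw) with LCD-dim1-classify C lcd
  ... | w , v , mw' , C≈R = w , (v , MinWeight-unique C mw' mw) , λ a → C≈R (proj₁ a)

NumLCD-dim1 : ∀ n → NumLCD n 1 (valII n)
NumLCD-dim1 n = representatives (subst (Enumeration (ValidWeight n)) (sym (valII≡#validWeights n)) (validWeights n))
  (lineCode n) (IsLCD-lineCode n) MinWeight (MinWeight-lineCode n) MinWeight-invariant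
  λ C lcd → let (w , v , _ , C≈R) = LCD-dim1-classify C lcd in w , v , C≈R

hyperplaneRep : ∀ n → ℕ → Code (suc n) n
hyperplaneRep n w = hyperplaneCode (canonical n (w ∸ 1))

HasCheckVector-hyperplaneRep : ∀ n w → 1 ≤ w → HasCheckVector (hyperplaneRep n w) (canonical (suc n) w)
HasCheckVector-hyperplaneRep n (suc w) _ = HasCheckVector-hyperplaneCode (canonical n w)

CheckWeight : ∀ {n k} → Code (suc n) k → ℕ → Set
CheckWeight {n} C w = ∃ λ (h' : Word n) → HasCheckVector C (𝟙 ∷ h') × wt (𝟙 ∷ h') ≡ w

CheckWeight-hyperplaneRep : ∀ n w → ValidWeight (suc n) w → CheckWeight (hyperplaneRep n w) w
CheckWeight-hyperplaneRep n (suc w) (_ , w+1≤n+1 , _) =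
  canonical n w , HasCheckVector-hyperplaneCode (canonical n w) , wt-canonical (suc n) (suc w) w+1≤n+1

CheckWeight-invariant : ∀ {n k} (C C' : Code (suc n) k) {w w'} →
  Equivalent C C' → CheckWeight C w → CheckWeight C' w' → w ≡ w'
CheckWeight-invariant C C' C≈C' (h , check , refl) (h' , check' , refl) = wt-check-invariant C C' h h' C≈C' check check'

IsLCD-hyperplaneRep : ∀ n w → ValidWeight (suc n) w → IsLCD (hyperplaneRep n w)
IsLCD-hyperplaneRep n (suc w) v =
  IsLCD-checked⇐ (hyperplaneRep n (suc w)) (canonical n w) (HasCheckVector-hyperplaneCode (canonical n w))
    (canonical·canonical≢𝟘 v)

-- The check vector of an LCD hyperplane is not self-orthogonal, and moving it to canonical form
-- moves the code onto a representative.
LCD-codim1-classify : ∀ {n} (C : Code (suc n) n) → IsLCD C →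
  ∃ λ w → ValidWeight (suc n) w × Equivalent C (hyperplaneRep n w)
LCD-codim1-classify {n} C lcd with hyperplane-check C
... | h , h≢0 , check with act-to-canonical h
...   | p , ph≡c =
  wt h , (≢0w⇒1≤wt h h≢0 , wt≤n h , IsLCD-checked⇒ C h h≢0 check lcd ∘ trans (·-self h)) ,
  Equivalent-checked C (hyperplaneRep n (wt h)) h (canonical (suc n) (wt h)) p check
    (HasCheckVector-hyperplaneRep n (wt h) (≢0w⇒1≤wt h h≢0)) ph≡c

NumLCD-codim1 : ∀ n → NumLCD (suc n) n (valII (suc n))
NumLCD-codim1 n = representatives
  (subst (Enumeration (ValidWeight (suc n))) (sym (valII≡#validWeights (suc n))) (validWeights (suc n)))
  (λ w _ → hyperplaneRep n w) (IsLCD-hyperplaneRep n) CheckWeight (CheckWeight-hyperplaneRep n) CheckWeight-invariant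
  λ C lcd → let (w , v , C≈R) = LCD-codim1-classify C lcd in w , v , λ _ → C≈R

HyperplaneWeight : ℕ → ℕ → ℕ → Set
HyperplaneWeight n d w = ValidWeight (suc n) w × ((d ≡ 1 × w < suc n) ⊎ (d ≡ 2 × w ≡ suc n))

MinWeight-hyperplaneRep : ∀ n → 1 ≤ n → ∀ d w → HyperplaneWeight n d w → MinWeight (hyperplaneRep n w) d
MinWeight-hyperplaneRep n       _ .1 (suc w)         (_ , inj₁ (refl , s≤s w<n)) = MinWeight-hyperplane-< n w w<n
MinWeight-hyperplaneRep (suc n) _ .2 .(suc (suc n))  (_ , inj₂ (refl , refl))    = MinWeight-hyperplane-full n

hyperplaneRep-distance : ∀ n → 1 ≤ n → ∀ d w → ValidWeight (suc n) w → MinWeight (hyperplaneRep n w) d →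
  (d ≡ 1 × w < suc n) ⊎ (d ≡ 2 × w ≡ suc n)
hyperplaneRep-distance (suc n) _ d (suc w) (_ , s≤s w≤n+1 , _) mw with ℕ.m≤n⇒m<n∨m≡n w≤n+1
... | inj₁ w<n+1 =
  inj₁ (MinWeight-unique (hyperplaneRep (suc n) (suc w)) mw (MinWeight-hyperplane-< (suc n) w w<n+1) , s≤s w<n+1)
... | inj₂ refl =
  inj₂ (MinWeight-unique (hyperplaneRep (suc n) (suc (suc n))) mw (MinWeight-hyperplane-full n) , refl)

hyperplaneWeights : ∀ n → 1 ≤ n → ∀ d → Enumeration (HyperplaneWeight n d) (valIII (suc n) d)
hyperplaneWeights n 1≤n zero = subst (Enumeration _) (sym (valIII-0 (suc n)))
  (Enumeration-∅ λ { w (_ , inj₁ (() , _)) ; w (_ , inj₂ (() , _)) })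
hyperplaneWeights n 1≤n (suc zero) = subst (Enumeration _) (sym (valIII-1≡#validWeights (suc n) (s≤s 1≤n)))
  (Enumeration-resp (λ w v → ValidWeight-weaken w v , inj₁ (refl , s≤s (proj₁ (proj₂ v))))
    (λ { w ((1≤w , _ , w≢0) , inj₁ (_ , s≤s w≤n)) → 1≤w , w≤n , w≢0 ; w (_ , inj₂ (() , _)) })
    (validWeights n))
hyperplaneWeights n 1≤n (suc (suc zero)) with fromℕ (suc n) ≟F 𝟘
... | yes n+1≡0 = subst (Enumeration _) (sym (trans (valIII-2≡isNonzero (suc n)) (cong isNonzero n+1≡0)))
  (Enumeration-∅ λ { w ((_ , _ , w≢0) , inj₂ (_ , refl)) → w≢0 n+1≡0 ; w (_ , inj₁ (() , _)) })
... | no n+1≢0  = subst (Enumeration _) (sym (trans (valIII-2≡isNonzero (suc n)) (isNonzero-≢𝟘 _ n+1≢0)))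
  (Enumeration-singleton (suc n) ((s≤s z≤n , ℕ.≤-refl , n+1≢0) , inj₂ (refl , refl))
    λ { w (_ , inj₂ (_ , w≡n+1)) → w≡n+1 ; w (_ , inj₁ (() , _)) })
hyperplaneWeights n 1≤n (suc (suc (suc d))) = subst (Enumeration _) (sym (valIII-3+ (suc n) d))
  (Enumeration-∅ λ { w (_ , inj₁ (() , _)) ; w (_ , inj₂ (() , _)) })

NumLCDd-codim1 : ∀ n → 1 ≤ n → ∀ d → NumLCDd (suc n) n d (valIII (suc n) d)
NumLCDd-codim1 n 1≤n d = representatives (hyperplaneWeights n 1≤n d) (λ w _ → hyperplaneRep n w)
  (λ w a → IsLCD-hyperplaneRep n w (proj₁ a) , MinWeight-hyperplaneRep n 1≤n d w a)
  CheckWeight (λ w a → CheckWeight-hyperplaneRep n w (proj₁ a)) CheckWeight-invariant classify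
  where
  classify : ∀ C → IsLCD C × MinWeight C d →
    ∃ λ w → HyperplaneWeight n d w × (HyperplaneWeight n d w → Equivalent C (hyperplaneRep n w))
  classify C (lcd , mw) with LCD-codim1-classify C lcd
  ... | w , v , C≈R =
    w , (v , hyperplaneRep-distance n 1≤n d w v (MinWeight-resp-Equivalent C (hyperplaneRep n w) C≈R mw)) , λ _ → C≈R

proposition3p2 : (n : ℕ) → 2 ≤ n →
    ((d : ℕ) → 1 ≤ d → d ≤ n → NumLCDd n 1 d (valI d)) ×
    (NumLCD n 1 (valII n) × NumLCD n (n ∸ 1) (valII n)) ×
    ((d : ℕ) → NumLCDd n (n ∸ 1) d (valIII n d))
proposition3p2 (suc n) (s≤s 1≤n) =
  NumLCDd-dim1 (suc n) , (NumLCD-dim1 (suc n) , NumLCD-codim1 n) , NumLCDd-codim1 n 1≤n
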